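{- Let $G$ be a connected, non-complete finite simple graph, and let $F$ be the subgraph of $G$ consisting of all forced edges of $G$ (together with their endpoints). Then $G=H^2$ for some graph $H$ with girth at least seven if and only if all of the following conditions hold: (i) every vertex in $V_G\setminus V_F$ belongs to exactly one maximal clique in $G$; (ii) every edge in $F$ belongs to exactly two distinct maximal cliques in $G$; (iii) every two non-disjoint edges in $F$ belong to a common maximal clique in $G$; (iv) for each maximal clique $Q$ of $G$, the induced subgraph $F[Q\cap V_F]$ is a star; (v) $F$ is connected and has girth at least seven.
   Context: All graphs are finite, undirected and simple. For a graph $H$, $H^2$ is the graph on the same vertex set in which two distinct vertices are adjacent iff their distance in $H$ is at most $2$. The girth of a graph is the length of a shortest cycle ($\infty$ if acyclic). A maximal clique is a set of pairwise adjacent vertices not properly contained in another such set. An edge of $G$ is called forced if it is contained in at least two distinct maximal cliques of $G$; $V_F$ denotes the vertex set of $F$. A star is a graph with at least two vertices that has a vertex adjacent to all other vertices (a center vertex), the other vertices being pairwise non-adjacent. $F[X]$ denotes the subgraph of $F$ induced by $X$. -}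

module Defs where

open import Data.Nat using (ℕ; suc; _≤_)
open import Data.Bool using (Bool; true; false; T)
open import Data.Fin using (Fin; zero; suc; fromℕ; inject₁)
open import Data.Fin.Subset using (Subset; _∈_; _⊆_)
open import Data.Product using (Σ; ∃; ∃-syntax; _×_; _,_)
open import Data.Sum using (_⊎_)
open import Relation.Nullary using (¬_)
open import Relation.Binary.PropositionalEquality using (_≡_; _≢_)
open import Function.Definitions using (Injective)
open import Function.Bundles using (_⇔_)

record SimpleGraph (n : ℕ) : Set where
  field
    adj    : Fin n → Fin n → Bool
    sym    : ∀ u v → adj u v ≡ adj v u
    irrefl : ∀ v → adj v v ≡ false

open SimpleGraph public

Adj : ∀ {n} → SimpleGraph n → Fin n → Fin n → Set
Adj G u v = T (adj G u v)

data Reach {n : ℕ} (R : Fin n → Fin n → Set) : Fin n → Fin n → Set where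
  here : ∀ {u} → Reach R u u
  step : ∀ {u v w} → R u v → Reach R v w → Reach R u w

-- a cycle of length (suc m) in R: injective c : Fin (suc m) → Fin n with
-- c i R c (i+1) for consecutive indices and c (last) R c 0
record Cycle {n : ℕ} (R : Fin n → Fin n → Set) (m : ℕ) : Set where
  field
    vert  : Fin (suc m) → Fin n
    inj   : Injective _≡_ _≡_ vert
    edges : ∀ (i : Fin m) → R (vert (inject₁ i)) (vert (suc i))
    close : R (vert (fromℕ m)) (vert zero)

-- girth at least seven: every cycle (length suc m ≥ 3) has length ≥ 7
GirthAtLeast7 : ∀ {n} → (Fin n → Fin n → Set) → Set
GirthAtLeast7 {n} R = ∀ (m : ℕ) → 2 ≤ m → Cycle R m → 7 ≤ suc m

Connected : ∀ {n} → SimpleGraph n → Set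
Connected {n} G = ∀ (u v : Fin n) → Reach (Adj G) u v

Complete : ∀ {n} → SimpleGraph n → Set
Complete {n} G = ∀ (u v : Fin n) → u ≢ v → Adj G u v

IsClique : ∀ {n} → SimpleGraph n → Subset n → Set
IsClique {n} G Q = ∀ (u v : Fin n) → u ∈ Q → v ∈ Q → u ≢ v → Adj G u v

IsMaxClique : ∀ {n} → SimpleGraph n → Subset n → Set
IsMaxClique {n} G Q =
  IsClique G Q × (∀ (Q' : Subset n) → IsClique G Q' → Q ⊆ Q' → Q' ⊆ Q)

Dist≤2 : ∀ {n} → SimpleGraph n → Fin n → Fin n → Set
Dist≤2 {n} H u v = u ≢ v × (Adj H u v ⊎ ∃[ w ] (Adj H u w × Adj H w v))

IsSquareOf : ∀ {n} → SimpleGraph n → SimpleGraph n → Set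
IsSquareOf {n} G H = ∀ (u v : Fin n) → Adj G u v ⇔ Dist≤2 H u v

Forced : ∀ {n} → SimpleGraph n → Fin n → Fin n → Set
Forced {n} G u v =
  Adj G u v ×
  ∃[ Q₁ ] ∃[ Q₂ ] (Q₁ ≢ Q₂ × IsMaxClique G Q₁ × IsMaxClique G Q₂ ×
                   u ∈ Q₁ × v ∈ Q₁ × u ∈ Q₂ × v ∈ Q₂)

InVF : ∀ {n} → SimpleGraph n → Fin n → Set
InVF G v = ∃[ u ] Forced G v u

CondI : ∀ {n} → SimpleGraph n → Set
CondI {n} G = ∀ (v : Fin n) → ¬ InVF G v →
  ∃[ Q ] (IsMaxClique G Q × v ∈ Q ×
          (∀ (Q' : Subset n) → IsMaxClique G Q' → v ∈ Q' → Q' ≡ Q))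

CondII : ∀ {n} → SimpleGraph n → Set
CondII {n} G = ∀ (u v : Fin n) → Forced G u v →
  ∃[ Q₁ ] ∃[ Q₂ ] (Q₁ ≢ Q₂ ×
    IsMaxClique G Q₁ × u ∈ Q₁ × v ∈ Q₁ ×
    IsMaxClique G Q₂ × u ∈ Q₂ × v ∈ Q₂ ×
    (∀ (Q : Subset n) → IsMaxClique G Q → u ∈ Q → v ∈ Q → Q ≡ Q₁ ⊎ Q ≡ Q₂))

CondIII : ∀ {n} → SimpleGraph n → Set
CondIII {n} G = ∀ (u v w : Fin n) → Forced G u v → Forced G v w →
  ∃[ Q ] (IsMaxClique G Q × u ∈ Q × v ∈ Q × w ∈ Q)

IsStarOn : ∀ {n} → (Fin n → Fin n → Set) → (Fin n → Set) → Set
IsStarOn {n} R X =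
  ∃[ c ] (X c ×
    (∃[ x ] (X x × x ≢ c)) ×
    (∀ (x : Fin n) → X x → x ≢ c → R c x) ×
    (∀ (x y : Fin n) → X x → X y → x ≢ c → y ≢ c → ¬ R x y))

CondIV : ∀ {n} → SimpleGraph n → Set
CondIV {n} G = ∀ (Q : Subset n) → IsMaxClique G Q →
  IsStarOn (Forced G) (λ x → x ∈ Q × InVF G x)

CondV : ∀ {n} → SimpleGraph n → Set
CondV {n} G =
  (∀ (u v : Fin n) → InVF G u → InVF G v → Reach (Forced G) u v) ×
  GirthAtLeast7 (Forced G)

module Submission where

-- If G = H² and H has girth at least 7, every maximal clique of G is the closed neighbourhood N[c]
-- of a vertex c of degree at least 2 in H, and the forced edges of G are exactly the edges of H
-- between such vertices; (i)–(v) are read off from this, since H has no cycles of length 3 to 6.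
-- Conversely, H is F together with one edge from each vertex v outside V_F to a hub of the unique
-- maximal clique Q containing v: a vertex of Q ∩ V_F that is F-adjacent to the rest of Q ∩ V_F and has
-- all its F-neighbours in Q. Hubs exist by (ii)–(iv), and two maximal cliques share a hub only
-- when F[Q ∩ V_F] is an isolated edge of F; its two maximal cliques are then given different
-- ends, so vertices of distinct cliques get distinct parents and G = H² follows.

open import Defs renaming (sym to adj-symmetric; irrefl to adj-irreflexive)
open import Data.Nat using (ℕ; zero; suc; _≤_; _<_; z≤n; s≤s; _<?_)
open import Data.Nat.Properties using (<⇒≱; suc-injective)
open import Data.Bool using (T)
open import Data.Bool.Properties using () renaming (_≟_ to _≟ᵇ_)
open import Data.Fin using (Fin; zero; suc; fromℕ; inject₁; toℕ)
open import Data.Fin.Properties using (any?; all?; toℕ-inject₁; <-asym; <-cmp) renaming (_≟_ to _≟ᶠ_)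
open import Data.Fin.Subset using (Subset; _∈_; _∉_; _⊆_; _∪_; ⁅_⁆)
open import Data.Fin.Subset.Properties using (_∈?_; _⊆?_; ⊆-antisym; x∈p∪q⁺; x∈p∪q⁻; p⊆p∪q; x∈⁅x⁆; x∈⁅y⁆⇒x≡y)
open import Data.Vec using (Vec; []; _∷_; lookup; tabulate)
open import Data.Vec.Properties using (lookup∘tabulate; []=⇒lookup; lookup⇒[]=; ≡-dec)
open import Data.Vec.Relation.Unary.Unique.Propositional using (Unique)
open import Data.Vec.Relation.Unary.Unique.Propositional.Properties using (lookup-injective)
open import Data.Vec.Relation.Unary.All using ([]; _∷_)
open import Data.Vec.Relation.Unary.AllPairs using ([]; _∷_)
open import Data.List using (List; allFin) renaming ([] to []ˡ; _∷_ to _∷ˡ_)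
open import Data.List.Membership.Propositional using () renaming (_∈_ to _∈ˡ_)
open import Data.List.Membership.Propositional.Properties using (∈-allFin)
open import Data.List.Relation.Unary.Any using (here; there)
open import Data.List.Relation.Unary.All using (All; []; _∷_) renaming (lookup to lookupᴬ; tabulate to tabulateᴬ)
open import Data.List.Relation.Unary.AllPairs using (AllPairs; []; _∷_)
open import Data.Product using (∃; ∃-syntax; _×_; _,_; proj₁; proj₂)
open import Data.Sum using (_⊎_; inj₁; inj₂; [_,_]′)
open import Data.Empty using (⊥; ⊥-elim)
open import Data.Unit using (⊤; tt)
open import Relation.Nullary using (¬_; Dec; yes; no; contradiction)
open import Relation.Nullary.Decidable using (T?; ¬?; _×-dec_; _⊎-dec_; _→-dec_; from-yes; decidable-stable; toWitness; fromWitness; isYes)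
open import Relation.Unary using (Decidable)
open import Relation.Binary.Definitions using (tri<; tri≈; tri>)
open import Relation.Binary.PropositionalEquality using (module ≡-Reasoning; _≡_; _≢_; refl; sym; trans; cong; subst; ≢-sym)
open import Function.Base using (_∘_; const)
open import Function.Bundles using (_⇔_; mk⇔; Equivalence)

module _ {n : ℕ} {R : Fin n → Fin n → Set} where

  vecCycle : ∀ {m} (xs : Vec (Fin n) (suc m)) → Unique xs →
             (∀ i → R (lookup xs (inject₁ i)) (lookup xs (suc i))) →
             R (lookup xs (fromℕ m)) (lookup xs zero) → Cycle R m
  vecCycle xs xs-unique path closing = record
    { vert = lookup xs ; inj = λ {i} {j} → lookup-injective xs-unique i j
    ; edges = path ; close = closing }

  Cycle-mapOn : ∀ {m} {S : Fin n → Fin n → Set} (P : Fin n → Set) →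
                (∀ {u v} → P u → P v → R u v → S u v) →
                (cy : Cycle R m) → (∀ i → P (Cycle.vert cy i)) → Cycle S m
  Cycle-mapOn P f cy on = record
    { vert = vert ; inj = inj
    ; edges = λ i → f (on _) (on _) (edges i) ; close = f (on _) (on _) close }
    where open Cycle cy

  GirthAtLeast7-mono : ∀ {S : Fin n → Fin n → Set} → (∀ {u v} → R u v → S u v) →
                       GirthAtLeast7 S → GirthAtLeast7 R
  GirthAtLeast7-mono {S} f girth m 2≤m cy =
    girth m 2≤m (Cycle-mapOn {S = S} (λ _ → ⊤) (λ _ _ → f) cy (λ _ → tt))

private
  lastOrInject : ∀ {p} (k : Fin (suc p)) → k ≡ fromℕ p ⊎ ∃[ i ] (inject₁ i ≡ suc k)
  lastOrInject {zero} zero = inj₁ refl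
  lastOrInject {suc p} zero = inj₂ (suc zero , refl)
  lastOrInject {suc p} (suc k) with lastOrInject k
  ... | inj₁ k≡last = inj₁ (cong suc k≡last)
  ... | inj₂ (i , eq) = inj₂ (suc i , cong suc eq)

  n≢2+n : ∀ (a : ℕ) → a ≢ suc (suc a)
  n≢2+n zero ()
  n≢2+n (suc a) eq = n≢2+n a (suc-injective eq)

-- The cycle has length suc m ≥ 3, so the predecessor and successor of k are distinct.
Cycle-twoNeighbours : ∀ {n} {R : Fin n → Fin n → Set} → (∀ {a b} → R a b → R b a) →
  ∀ m → 2 ≤ m → (cy : Cycle R m) → ∀ k →
  ∃[ i ] ∃[ j ] (i ≢ j × R (Cycle.vert cy k) (Cycle.vert cy i) × R (Cycle.vert cy k) (Cycle.vert cy j))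
Cycle-twoNeighbours R-sym (suc zero) (s≤s ()) cy k
Cycle-twoNeighbours R-sym (suc (suc m)) _ cy zero =
  suc zero , fromℕ (suc (suc m)) , (λ ()) , Cycle.edges cy zero , R-sym (Cycle.close cy)
Cycle-twoNeighbours {R = R} R-sym (suc (suc m)) _ cy (suc k) with lastOrInject k
... | inj₁ refl = inject₁ k , zero , (λ ()) , R-sym (Cycle.edges cy k) , Cycle.close cy
... | inj₂ (i , eq) = inject₁ k , suc i , distinct , R-sym (Cycle.edges cy k) ,
                      subst (λ z → R (Cycle.vert cy z) (Cycle.vert cy (suc i))) eq (Cycle.edges cy i)
  where
  distinct : inject₁ k ≢ suc i
  distinct k≡1+i = n≢2+n (toℕ k) (begin
    toℕ k                  ≡⟨ toℕ-inject₁ k ⟨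
    toℕ (inject₁ k)        ≡⟨ cong toℕ k≡1+i ⟩
    suc (toℕ i)            ≡⟨ cong suc (toℕ-inject₁ i) ⟨
    suc (toℕ (inject₁ i))  ≡⟨ cong (suc ∘ toℕ) eq ⟩
    suc (suc (toℕ k))      ∎)
    where open ≡-Reasoning

module ShortCycles {n : ℕ} (R : Fin n → Fin n → Set) (R-irrefl : ∀ {a} → ¬ R a a)
                   (girth : GirthAtLeast7 R) where

  R⇒≢ : ∀ {a b} → R a b → a ≢ b
  R⇒≢ r refl = R-irrefl r

  private
    shorterThan7 : ∀ {m} → 2 ≤ m → suc m < 7 → ¬ Cycle R m
    shorterThan7 {m} 2≤m short cy = <⇒≱ short (girth m 2≤m cy)

  no-triangle : ∀ {a b c} → R a b → R b c → R c a → ⊥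
  no-triangle {a} {b} {c} ab bc ca =
    shorterThan7 (s≤s (s≤s z≤n)) (from-yes (3 <? 7))
      (vecCycle (a ∷ b ∷ c ∷ [])
        ((R⇒≢ ab ∷ ≢-sym (R⇒≢ ca) ∷ []) ∷ (R⇒≢ bc ∷ []) ∷ [] ∷ [])
        (λ { zero → ab ; (suc zero) → bc }) ca)

  no-4-cycle : ∀ {a b c d} → R a b → R b c → R c d → R d a → a ≢ c → b ≢ d → ⊥
  no-4-cycle {a} {b} {c} {d} ab bc cd da a≢c b≢d =
    shorterThan7 (s≤s (s≤s z≤n)) (from-yes (4 <? 7))
      (vecCycle (a ∷ b ∷ c ∷ d ∷ [])
        ((R⇒≢ ab ∷ a≢c ∷ ≢-sym (R⇒≢ da) ∷ []) ∷ (R⇒≢ bc ∷ b≢d ∷ []) ∷ (R⇒≢ cd ∷ []) ∷ [] ∷ [])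
        (λ { zero → ab ; (suc zero) → bc ; (suc (suc zero)) → cd }) da)

  no-5-cycle : ∀ {a b c d e} → R a b → R b c → R c d → R d e → R e a →
               a ≢ c → b ≢ d → c ≢ e → d ≢ a → e ≢ b → ⊥
  no-5-cycle {a} {b} {c} {d} {e} ab bc cd de ea a≢c b≢d c≢e d≢a e≢b =
    shorterThan7 (s≤s (s≤s z≤n)) (from-yes (5 <? 7))
      (vecCycle (a ∷ b ∷ c ∷ d ∷ e ∷ [])
        ((R⇒≢ ab ∷ a≢c ∷ ≢-sym d≢a ∷ ≢-sym (R⇒≢ ea) ∷ []) ∷ (R⇒≢ bc ∷ b≢d ∷ ≢-sym e≢b ∷ []) ∷
         (R⇒≢ cd ∷ c≢e ∷ []) ∷ (R⇒≢ de ∷ []) ∷ [] ∷ [])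
        (λ { zero → ab ; (suc zero) → bc ; (suc (suc zero)) → cd ; (suc (suc (suc zero))) → de }) ea)

  -- A coincidence of opposite vertices would close a triangle.
  no-6-cycle : ∀ {a b c d e f} → R a b → R b c → R c d → R d e → R e f → R f a →
               a ≢ c → b ≢ d → c ≢ e → d ≢ f → e ≢ a → f ≢ b → ⊥
  no-6-cycle {a} {b} {c} {d} {e} {f} ab bc cd de ef fa a≢c b≢d c≢e d≢f e≢a f≢b
    with a ≟ᶠ d | b ≟ᶠ e | c ≟ᶠ f
  ... | yes refl | _        | _        = no-triangle ab bc cd
  ... | no _     | yes refl | _        = no-triangle bc cd de
  ... | no _     | no _     | yes refl = no-triangle cd de ef
  ... | no a≢d   | no b≢e   | no c≢f   =
    shorterThan7 (s≤s (s≤s z≤n)) (from-yes (6 <? 7))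
      (vecCycle (a ∷ b ∷ c ∷ d ∷ e ∷ f ∷ [])
        ((R⇒≢ ab ∷ a≢c ∷ a≢d ∷ ≢-sym e≢a ∷ ≢-sym (R⇒≢ fa) ∷ []) ∷
         (R⇒≢ bc ∷ b≢d ∷ b≢e ∷ ≢-sym f≢b ∷ []) ∷ (R⇒≢ cd ∷ c≢e ∷ c≢f ∷ []) ∷
         (R⇒≢ de ∷ d≢f ∷ []) ∷ (R⇒≢ ef ∷ []) ∷ [] ∷ [])
        (λ { zero → ab ; (suc zero) → bc ; (suc (suc zero)) → cd
           ; (suc (suc (suc zero))) → de ; (suc (suc (suc (suc zero)))) → ef }) fa)

module _ {n : ℕ} {R : Fin n → Fin n → Set} where

  Reach-trans : ∀ {a b c} → Reach R a b → Reach R b c → Reach R a c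
  Reach-trans here bc = bc
  Reach-trans (step ab rest) bc = step ab (Reach-trans rest bc)

  Reach-sym : (∀ {a b} → R a b → R b a) → ∀ {a b} → Reach R a b → Reach R b a
  Reach-sym R-sym here = here
  Reach-sym R-sym (step ab rest) = Reach-trans (Reach-sym R-sym rest) (step (R-sym ab) here)

IsStarOn-no-path3 : ∀ {n} {R : Fin n → Fin n → Set} {X : Fin n → Set} → IsStarOn R X →
  ∀ {a b c d} → X a → X b → X c → X d → R a b → R b c → R c d → a ≢ c → b ≢ c → b ≢ d → ⊥
IsStarOn-no-path3 (s , _ , _ , _ , leaves-apart) {a} {b} {c} {d} Xa Xb Xc Xd ab bc cd a≢c b≢c b≢d
  with b ≟ᶠ s | c ≟ᶠ s
... | yes refl | _        = leaves-apart c d Xc Xd (≢-sym b≢c) (≢-sym b≢d) cd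
... | no _     | yes refl = leaves-apart a b Xa Xb a≢c b≢c ab
... | no b≢s   | no c≢s   = leaves-apart b c Xb Xc b≢s c≢s bc

module _ {n : ℕ} where

  toSubset : {P : Fin n → Set} → Decidable P → Subset n
  toSubset P? = tabulate (λ x → isYes (P? x))

  ∈-toSubset⁺ : ∀ {P : Fin n → Set} (P? : Decidable P) {x} → P x → x ∈ toSubset P?
  ∈-toSubset⁺ P? {x} px with P? x in eq
  ... | yes _ = lookup⇒[]= x _ (trans (lookup∘tabulate _ x) (cong isYes eq))
  ... | no ¬px = contradiction px ¬px

  ∈-toSubset⁻ : ∀ {P : Fin n → Set} (P? : Decidable P) {x} → x ∈ toSubset P? → P x
  ∈-toSubset⁻ P? {x} x∈ with P? x in eq
  ... | yes px = px
  ... | no _ with trans (sym ([]=⇒lookup x∈)) (trans (lookup∘tabulate _ x) (cong isYes eq))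
  ...   | ()

  ⊈⇒∃∉ : ∀ {P Q : Subset n} → ¬ P ⊆ Q → ∃[ x ] (x ∈ P × x ∉ Q)
  ⊈⇒∃∉ {P} {Q} P⊈Q with any? (λ x → x ∈? P ×-dec ¬? (x ∈? Q))
  ... | yes witness = witness
  ... | no none = contradiction (λ {x} x∈P → decidable-stable (x ∈? Q) (λ x∉Q → none (x , x∈P , x∉Q))) P⊈Q

  ⊆⊎∃∉ : ∀ (P Q : Subset n) → P ⊆ Q ⊎ ∃[ x ] (x ∈ P × x ∉ Q)
  ⊆⊎∃∉ P Q with P ⊆? Q
  ... | yes P⊆Q = inj₁ P⊆Q
  ... | no P⊈Q  = inj₂ (⊈⇒∃∉ P⊈Q)

  ≢⇒separated : ∀ {P Q : Subset n} → P ≢ Q → ∃[ x ] ((x ∈ P × x ∉ Q) ⊎ (x ∈ Q × x ∉ P))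
  ≢⇒separated {P} {Q} P≢Q with ⊆⊎∃∉ P Q | ⊆⊎∃∉ Q P
  ... | inj₁ P⊆Q | inj₁ Q⊆P = contradiction (⊆-antisym P⊆Q Q⊆P) P≢Q
  ... | inj₂ (x , sep) | _  = x , inj₁ sep
  ... | inj₁ _ | inj₂ (x , sep) = x , inj₂ sep

  _≟ˢ_ : (P Q : Subset n) → Dec (P ≡ Q)
  _≟ˢ_ = ≡-dec _≟ᵇ_

isYes-⇔ : ∀ {A B : Set} (a? : Dec A) (b? : Dec B) → (A → B) → (B → A) → isYes a? ≡ isYes b?
isYes-⇔ (yes _) (yes _) _ _ = refl
isYes-⇔ (no _)  (no _)  _ _ = refl
isYes-⇔ (yes a) (no ¬b) f _ = contradiction (f a) ¬b
isYes-⇔ (no ¬a) (yes b) _ g = contradiction (g b) ¬a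

module _ {A : Set} {R : A → A → Set} where

  AllPairs-∈ : ∀ {xs x y} → AllPairs R xs → x ∈ˡ xs → y ∈ˡ xs → x ≡ y ⊎ R x y ⊎ R y x
  AllPairs-∈ (_ ∷ _)    (here refl)  (here refl)  = inj₁ refl
  AllPairs-∈ (rs ∷ _)   (here refl)  (there y∈)   = inj₂ (inj₁ (lookupᴬ rs y∈))
  AllPairs-∈ (rs ∷ _)   (there x∈)   (here refl)  = inj₂ (inj₂ (lookupᴬ rs x∈))
  AllPairs-∈ (_ ∷ rss)  (there x∈)   (there y∈)   = AllPairs-∈ rss x∈ y∈

module Cliques {n : ℕ} (G : SimpleGraph n) where

  adj? : ∀ u v → Dec (Adj G u v)
  adj? u v = T? (adj G u v)

  Adj-sym : ∀ {u v} → Adj G u v → Adj G v u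
  Adj-sym {u} {v} = subst T (adj-symmetric G u v)

  Adj-irrefl : ∀ {u} → ¬ Adj G u u
  Adj-irrefl {u} = subst T (adj-irreflexive G u)

  Adj⇒≢ : ∀ {u v} → Adj G u v → u ≢ v
  Adj⇒≢ uv refl = Adj-irrefl uv

  Blocked : Fin n → Subset n → Set
  Blocked v Q = ∃[ u ] (u ∈ Q × u ≢ v × ¬ Adj G u v)

  blocked? : ∀ v Q → Dec (Blocked v Q)
  blocked? v Q = any? (λ u → u ∈? Q ×-dec ¬? (u ≟ᶠ v) ×-dec ¬? (adj? u v))

  ¬Blocked⇒Adj : ∀ {u v Q} → ¬ Blocked v Q → u ∈ Q → u ≢ v → Adj G u v
  ¬Blocked⇒Adj {u} {v} unblocked u∈Q u≢v = decidable-stable (adj? u v) (λ ¬uv → unblocked (u , u∈Q , u≢v , ¬uv))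

  ∪⁅⁆-isClique : ∀ {v Q} → IsClique G Q → ¬ Blocked v Q → IsClique G (Q ∪ ⁅ v ⁆)
  ∪⁅⁆-isClique {v} {Q} Q-clique unblocked x y x∈ y∈ x≢y
    with x∈p∪q⁻ Q ⁅ v ⁆ x∈ | x∈p∪q⁻ Q ⁅ v ⁆ y∈
  ... | inj₁ x∈Q | inj₁ y∈Q = Q-clique x y x∈Q y∈Q x≢y
  ... | inj₁ x∈Q | inj₂ y∈v rewrite x∈⁅y⁆⇒x≡y v y∈v = ¬Blocked⇒Adj unblocked x∈Q x≢y
  ... | inj₂ x∈v | inj₁ y∈Q rewrite x∈⁅y⁆⇒x≡y v x∈v = Adj-sym (¬Blocked⇒Adj unblocked y∈Q (≢-sym x≢y))
  ... | inj₂ x∈v | inj₂ y∈v = contradiction (trans (x∈⁅y⁆⇒x≡y v x∈v) (sym (x∈⁅y⁆⇒x≡y v y∈v))) x≢y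

  IsMaxClique-blocks : ∀ {Q v} → IsMaxClique G Q → v ∉ Q → Blocked v Q
  IsMaxClique-blocks {Q} {v} (Q-clique , Q-max) v∉Q with blocked? v Q
  ... | yes blocked = blocked
  ... | no unblocked =
    contradiction (Q-max (Q ∪ ⁅ v ⁆) (∪⁅⁆-isClique Q-clique unblocked) (p⊆p∪q ⁅ v ⁆) (x∈p∪q⁺ (inj₂ (x∈⁅x⁆ v)))) v∉Q

  isMaxClique : ∀ {Q} → IsClique G Q → (∀ v → v ∉ Q → Blocked v Q) → IsMaxClique G Q
  isMaxClique {Q} Q-clique blocks = Q-clique , λ Q' Q'-clique Q⊆Q' {v} v∈Q' →
    decidable-stable (v ∈? Q) λ v∉Q →
      let (u , u∈Q , u≢v , ¬uv) = blocks v v∉Q in ¬uv (Q'-clique u v (Q⊆Q' u∈Q) v∈Q' u≢v)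

  grow : Fin n → Subset n → Subset n
  grow v Q with blocked? v Q
  ... | yes _ = Q
  ... | no _  = Q ∪ ⁅ v ⁆

  grow-⊇ : ∀ v Q → Q ⊆ grow v Q
  grow-⊇ v Q with blocked? v Q
  ... | yes _ = λ x∈Q → x∈Q
  ... | no _  = p⊆p∪q ⁅ v ⁆

  grow-isClique : ∀ v {Q} → IsClique G Q → IsClique G (grow v Q)
  grow-isClique v {Q} Q-clique with blocked? v Q
  ... | yes _ = Q-clique
  ... | no unblocked = ∪⁅⁆-isClique Q-clique unblocked

  Settled : Fin n → Subset n → Set
  Settled v Q = v ∈ Q ⊎ Blocked v Q

  Settled-mono : ∀ {v Q Q'} → Q ⊆ Q' → Settled v Q → Settled v Q'
  Settled-mono Q⊆Q' (inj₁ v∈Q) = inj₁ (Q⊆Q' v∈Q)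
  Settled-mono Q⊆Q' (inj₂ (u , u∈Q , rest)) = inj₂ (u , Q⊆Q' u∈Q , rest)

  grow-settles : ∀ v Q → Settled v (grow v Q)
  grow-settles v Q with blocked? v Q
  ... | yes blocked = inj₂ blocked
  ... | no _ = inj₁ (x∈p∪q⁺ (inj₂ (x∈⁅x⁆ v)))

  growAll : List (Fin n) → Subset n → Subset n
  growAll []ˡ Q = Q
  growAll (v ∷ˡ vs) Q = growAll vs (grow v Q)

  growAll-⊇ : ∀ vs Q → Q ⊆ growAll vs Q
  growAll-⊇ []ˡ Q x∈Q = x∈Q
  growAll-⊇ (v ∷ˡ vs) Q x∈Q = growAll-⊇ vs (grow v Q) (grow-⊇ v Q x∈Q)

  growAll-isClique : ∀ vs {Q} → IsClique G Q → IsClique G (growAll vs Q)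
  growAll-isClique []ˡ Q-clique = Q-clique
  growAll-isClique (v ∷ˡ vs) Q-clique = growAll-isClique vs (grow-isClique v Q-clique)

  growAll-settles : ∀ vs Q {v} → v ∈ˡ vs → Settled v (growAll vs Q)
  growAll-settles (v ∷ˡ vs) Q (here refl) = Settled-mono (growAll-⊇ vs (grow v Q)) (grow-settles v Q)
  growAll-settles (_ ∷ˡ vs) Q (there v∈vs) = growAll-settles vs _ v∈vs

  extend-to-maxClique : ∀ {S} → IsClique G S → ∃[ Q ] (IsMaxClique G Q × S ⊆ Q)
  extend-to-maxClique {S} S-clique =
    growAll (allFin n) S ,
    isMaxClique (growAll-isClique (allFin n) S-clique) blocks ,
    growAll-⊇ (allFin n) S
    where
    blocks : ∀ v → v ∉ growAll (allFin n) S → Blocked v (growAll (allFin n) S)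
    blocks v v∉ with growAll-settles (allFin n) S (∈-allFin v)
    ... | inj₁ v∈ = contradiction v∈ v∉
    ... | inj₂ blocked = blocked

  IsMaxClique-⊆⇒≡ : ∀ {Q Q'} → IsMaxClique G Q → IsClique G Q' → Q ⊆ Q' → Q ≡ Q'
  IsMaxClique-⊆⇒≡ (_ , Q-max) Q'-clique Q⊆Q' = ⊆-antisym Q⊆Q' (Q-max _ Q'-clique Q⊆Q')

  maxClique-⊇ : ∀ xs → AllPairs (λ x y → x ≢ y → Adj G x y) xs →
                ∃[ Q ] (IsMaxClique G Q × All (_∈ Q) xs)
  maxClique-⊇ xs pairwise =
    let (Q , Q-max , S⊆Q) = extend-to-maxClique S-clique
    in Q , Q-max , tabulateᴬ (λ x∈xs → S⊆Q (∈-toSubset⁺ (_∈ˡ? xs) x∈xs))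
    where
    open import Data.List.Membership.DecPropositional (_≟ᶠ_ {n}) using () renaming (_∈?_ to _∈ˡ?_)
    S = toSubset (_∈ˡ? xs)
    S-clique : IsClique G S
    S-clique x y x∈S y∈S x≢y
      with AllPairs-∈ pairwise (∈-toSubset⁻ (_∈ˡ? xs) x∈S) (∈-toSubset⁻ (_∈ˡ? xs) y∈S)
    ... | inj₁ x≡y = contradiction x≡y x≢y
    ... | inj₂ (inj₁ xy) = xy x≢y
    ... | inj₂ (inj₂ yx) = Adj-sym (yx (≢-sym x≢y))

module ForcedEdges {n : ℕ} (G : SimpleGraph n) where
  open Cliques G

  -- Two maximal cliques through uv are told apart by a pair of non-adjacent common neighbours.
  TwoCommonNonNeighbours : Fin n → Fin n → Set
  TwoCommonNonNeighbours u v =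
    ∃[ x ] ∃[ y ] (x ≢ y × (Adj G u x × Adj G v x) × (Adj G u y × Adj G v y) × ¬ Adj G x y)

  twoCommonNonNeighbours? : ∀ u v → Dec (TwoCommonNonNeighbours u v)
  twoCommonNonNeighbours? u v = any? λ x → any? λ y →
    ¬? (x ≟ᶠ y) ×-dec (adj? u x ×-dec adj? v x) ×-dec (adj? u y ×-dec adj? v y) ×-dec ¬? (adj? x y)

  private
    separated⇒TwoCommon : ∀ {Q₁ Q₂ u v x} → Adj G u v → IsMaxClique G Q₁ → IsMaxClique G Q₂ →
      u ∈ Q₁ → v ∈ Q₁ → u ∈ Q₂ → v ∈ Q₂ → x ∈ Q₁ → x ∉ Q₂ → TwoCommonNonNeighbours u v
    separated⇒TwoCommon {u = u} {v} {x} uv (clique₁ , _) max₂@(clique₂ , _) u∈₁ v∈₁ u∈₂ v∈₂ x∈₁ x∉₂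
      with IsMaxClique-blocks max₂ x∉₂
    ... | y , y∈₂ , y≢x , ¬yx = x , y , ≢-sym y≢x , (ux , vx) , (uy , vy) , ¬yx ∘ Adj-sym
      where
      ux = clique₁ u x u∈₁ x∈₁ (λ { refl → x∉₂ u∈₂ })
      vx = clique₁ v x v∈₁ x∈₁ (λ { refl → x∉₂ v∈₂ })
      uy = clique₂ u y u∈₂ y∈₂ (λ { refl → ¬yx ux })
      vy = clique₂ v y v∈₂ y∈₂ (λ { refl → ¬yx vx })

  Forced⇒TwoCommon : ∀ {u v} → Forced G u v → TwoCommonNonNeighbours u v
  Forced⇒TwoCommon (uv , Q₁ , Q₂ , Q₁≢Q₂ , max₁ , max₂ , u∈₁ , v∈₁ , u∈₂ , v∈₂) with ≢⇒separated Q₁≢Q₂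
  ... | x , inj₁ (x∈₁ , x∉₂) = separated⇒TwoCommon uv max₁ max₂ u∈₁ v∈₁ u∈₂ v∈₂ x∈₁ x∉₂
  ... | x , inj₂ (x∈₂ , x∉₁) = separated⇒TwoCommon uv max₂ max₁ u∈₂ v∈₂ u∈₁ v∈₁ x∈₂ x∉₁

  TwoCommon⇒Forced : ∀ {u v} → Adj G u v → TwoCommonNonNeighbours u v → Forced G u v
  TwoCommon⇒Forced {u} {v} uv (x , y , x≢y , (ux , vx) , (uy , vy) , ¬xy)
    with maxClique-⊇ (u ∷ˡ v ∷ˡ x ∷ˡ []ˡ) ((const uv ∷ const ux ∷ []) ∷ (const vx ∷ []) ∷ [] ∷ [])
       | maxClique-⊇ (u ∷ˡ v ∷ˡ y ∷ˡ []ˡ) ((const uv ∷ const uy ∷ []) ∷ (const vy ∷ []) ∷ [] ∷ [])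
  ... | Q₁ , max₁ , u∈₁ ∷ v∈₁ ∷ x∈₁ ∷ [] | Q₂ , max₂ , u∈₂ ∷ v∈₂ ∷ y∈₂ ∷ [] =
    uv , Q₁ , Q₂ , Q₁≢Q₂ , max₁ , max₂ , u∈₁ , v∈₁ , u∈₂ , v∈₂
    where
    Q₁≢Q₂ : Q₁ ≢ Q₂
    Q₁≢Q₂ refl = ¬xy (proj₁ max₁ x y x∈₁ y∈₂ x≢y)

  forced? : ∀ u v → Dec (Forced G u v)
  forced? u v with adj? u v ×-dec twoCommonNonNeighbours? u v
  ... | yes (uv , common) = yes (TwoCommon⇒Forced uv common)
  ... | no ¬forced = no (λ f → ¬forced (proj₁ f , Forced⇒TwoCommon f))

  inVF? : ∀ v → Dec (InVF G v)
  inVF? v = any? (forced? v)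

  Forced-sym : ∀ {u v} → Forced G u v → Forced G v u
  Forced-sym (uv , Q₁ , Q₂ , Q₁≢Q₂ , max₁ , max₂ , u∈₁ , v∈₁ , u∈₂ , v∈₂) =
    Adj-sym uv , Q₁ , Q₂ , Q₁≢Q₂ , max₁ , max₂ , v∈₁ , u∈₁ , v∈₂ , u∈₂

  Forced-irrefl : ∀ {u} → ¬ Forced G u u
  Forced-irrefl (uu , _) = Adj-irrefl uu

  Forced⇒≢ : ∀ {u v} → Forced G u v → u ≢ v
  Forced⇒≢ (uv , _) = Adj⇒≢ uv

  Forced⇒InVFˡ : ∀ {u v} → Forced G u v → InVF G u
  Forced⇒InVFˡ {v = v} f = v , f

  Forced⇒InVFʳ : ∀ {u v} → Forced G u v → InVF G v
  Forced⇒InVFʳ {u} f = u , Forced-sym f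

module SquareOfHighGirth {n : ℕ} (G H : SimpleGraph n) (connected : Connected G)
                         (incomplete : ¬ Complete G) (square : IsSquareOf G H)
                         (girth : GirthAtLeast7 (Adj H)) where
  open Cliques G
  open ForcedEdges G
  open Cliques H using () renaming (adj? to _~?_; Adj-sym to ~-sym; Adj-irrefl to ~-irrefl; Adj⇒≢ to ~⇒≢)
  open ShortCycles (Adj H) ~-irrefl girth

  infix 4 _~_
  _~_ : Fin n → Fin n → Set
  _~_ = Adj H

  Dist≤2⇒Adj : ∀ {u v} → Dist≤2 H u v → Adj G u v
  Dist≤2⇒Adj = Equivalence.from (square _ _)

  Adj⇒Dist≤2 : ∀ {u v} → Adj G u v → Dist≤2 H u v
  Adj⇒Dist≤2 = Equivalence.to (square _ _)

  ~⇒Adj : ∀ {u v} → u ~ v → Adj G u v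
  ~⇒Adj uv = Dist≤2⇒Adj (~⇒≢ uv , inj₁ uv)

  ~~⇒Adj : ∀ {u w v} → u ≢ v → u ~ w → w ~ v → Adj G u v
  ~~⇒Adj u≢v uw wv = Dist≤2⇒Adj (u≢v , inj₂ (_ , uw , wv))

  Adj-closed⇒everywhere : ∀ {P : Fin n → Set} {x} → P x →
                          (∀ {z z'} → P z → Adj G z z' → P z') → ∀ y → P y
  Adj-closed⇒everywhere {P} {x} Px closed y = along (connected x y) Px
    where
    along : ∀ {a b} → Reach (Adj G) a b → P a → P b
    along here Pa = Pa
    along (step ab rest) Pa = along rest (closed Pa ab)

  ∃nonAdjacent : ∃[ a ] ∃[ b ] (a ≢ b × ¬ Adj G a b)
  ∃nonAdjacent with any? (λ a → any? λ b → ¬? (a ≟ᶠ b) ×-dec ¬? (adj? a b))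
  ... | yes witness = witness
  ... | no none = contradiction (λ a b a≢b → decidable-stable (adj? a b) (λ ¬ab → none (a , b , a≢b , ¬ab)))
                                incomplete

  ∃≢ : ∀ u → ∃[ z ] u ≢ z
  ∃≢ u with ∃nonAdjacent
  ... | a , b , a≢b , _ with u ≟ᶠ a
  ...   | yes refl = b , a≢b
  ...   | no u≢a   = a , u≢a

  ∃Adj : ∀ u → ∃[ y ] Adj G u y
  ∃Adj u = let (z , u≢z) = ∃≢ u in firstStep (connected u z) u≢z
    where
    firstStep : ∀ {z} → Reach (Adj G) u z → u ≢ z → ∃[ y ] Adj G u y
    firstStep here u≢u = contradiction refl u≢u
    firstStep (step uy _) _ = _ , uy

  ∃~ : ∀ u → ∃[ w ] u ~ w
  ∃~ u with Adj⇒Dist≤2 (proj₂ (∃Adj u))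
  ... | _ , inj₁ uy = _ , uy
  ... | _ , inj₂ (w , uw , _) = w , uw

  Branch : Fin n → Set
  Branch v = ∃[ x ] ∃[ y ] (x ≢ y × v ~ x × v ~ y)

  branch? : ∀ v → Dec (Branch v)
  branch? v = any? λ x → any? λ y → ¬? (x ≟ᶠ y) ×-dec v ~? x ×-dec v ~? y

  leaf-~-unique : ∀ {v x y} → ¬ Branch v → v ~ x → v ~ y → x ≡ y
  leaf-~-unique {v} {x} {y} leaf vx vy = decidable-stable (x ≟ᶠ y) λ x≢y → leaf (x , y , x≢y , vx , vy)

  N[_] : Fin n → Subset n
  N[ v ] = toSubset (λ x → x ≟ᶠ v ⊎-dec v ~? x)

  ∈N[]⁻ : ∀ {v x} → x ∈ N[ v ] → x ≡ v ⊎ v ~ x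
  ∈N[]⁻ {v} = ∈-toSubset⁻ (λ x → x ≟ᶠ v ⊎-dec v ~? x)

  ∈N[]⁺ : ∀ {v x} → x ≡ v ⊎ v ~ x → x ∈ N[ v ]
  ∈N[]⁺ {v} = ∈-toSubset⁺ (λ x → x ≟ᶠ v ⊎-dec v ~? x)

  self∈N[] : ∀ {v} → v ∈ N[ v ]
  self∈N[] = ∈N[]⁺ (inj₁ refl)

  ~⇒∈N[] : ∀ {v x} → v ~ x → x ∈ N[ v ]
  ~⇒∈N[] vx = ∈N[]⁺ (inj₂ vx)

  ∉N[]⇒≢ : ∀ {v x} → x ∉ N[ v ] → x ≢ v
  ∉N[]⇒≢ x∉ refl = x∉ self∈N[]

  ∉N[]⇒≁ : ∀ {v x} → x ∉ N[ v ] → ¬ v ~ x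
  ∉N[]⇒≁ x∉ vx = x∉ (~⇒∈N[] vx)

  N[]-isClique : ∀ v → IsClique G N[ v ]
  N[]-isClique v x y x∈ y∈ x≢y with ∈N[]⁻ x∈ | ∈N[]⁻ y∈
  ... | inj₁ refl | inj₁ refl = contradiction refl x≢y
  ... | inj₁ refl | inj₂ vy   = ~⇒Adj vy
  ... | inj₂ vx   | inj₁ refl = ~⇒Adj (~-sym vx)
  ... | inj₂ vx   | inj₂ vy   = ~~⇒Adj x≢y (~-sym vx) vy

  Branch⇒~≢ : ∀ {w} → Branch w → ∀ p → ∃[ r ] (w ~ r × r ≢ p)
  Branch⇒~≢ (x , y , x≢y , wx , wy) p with x ≟ᶠ p
  ... | yes refl = y , wy , ≢-sym x≢y
  ... | no x≢p   = x , wx , x≢p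

  N[]-isMaxClique : ∀ {w} → Branch w → IsMaxClique G N[ w ]
  N[]-isMaxClique {w} w-branch = isMaxClique (N[]-isClique w) blocks
    where
    blocks : ∀ v → v ∉ N[ w ] → Blocked v N[ w ]
    blocks v v∉ with adj? w v
    ... | no ¬wv = w , self∈N[] , ≢-sym (∉N[]⇒≢ v∉) , ¬wv
    ... | yes wv with Adj⇒Dist≤2 wv
    ...   | _ , inj₁ w~v = contradiction w~v (∉N[]⇒≁ v∉)
    ...   | _ , inj₂ (p , wp , pv) with Branch⇒~≢ w-branch p
    ...     | r , wr , r≢p = r , ~⇒∈N[] wr , (λ { refl → v∉ (~⇒∈N[] wr) }) , ¬rv
      where
      ¬rv : ¬ Adj G r v
      ¬rv rv with Adj⇒Dist≤2 rv
      ... | _ , inj₁ r~v = no-4-cycle (~-sym pv) (~-sym wp) wr r~v (∉N[]⇒≢ v∉) (≢-sym r≢p)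
      ... | _ , inj₂ (s , rs , sv) with s ≟ᶠ p
      ...   | yes refl = no-triangle wp (~-sym rs) (~-sym wr)
      ...   | no s≢p = no-5-cycle wp pv (~-sym sv) (~-sym rs) (~-sym wr)
                         (≢-sym (∉N[]⇒≢ v∉)) (≢-sym s≢p) (λ { refl → v∉ (~⇒∈N[] wr) })
                         (λ { refl → ∉N[]⇒≁ v∉ sv }) r≢p

  -- Were u and v leaves of one edge, G would be that edge and hence complete.
  no-leaf-edge : ∀ {u v} → u ~ v → ¬ Branch u → ¬ Branch v → ⊥
  no-leaf-edge {u} {v} uv u-leaf v-leaf =
    let (a , b , a≢b , ¬ab) = ∃nonAdjacent in ¬ab (adjacentEnds (everywhere a) (everywhere b) a≢b)
    where
    Ends : Fin n → Set
    Ends z = z ≡ u ⊎ z ≡ v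
    ~-closed : ∀ {z x} → Ends z → z ~ x → Ends x
    ~-closed (inj₁ refl) ux = inj₂ (leaf-~-unique u-leaf ux uv)
    ~-closed (inj₂ refl) vx = inj₁ (leaf-~-unique v-leaf vx (~-sym uv))
    Adj-closed : ∀ {z z'} → Ends z → Adj G z z' → Ends z'
    Adj-closed z∈ zz' with Adj⇒Dist≤2 zz'
    ... | _ , inj₁ z~z' = ~-closed z∈ z~z'
    ... | _ , inj₂ (_ , zp , pz') = ~-closed (~-closed z∈ zp) pz'
    everywhere : ∀ y → Ends y
    everywhere = Adj-closed⇒everywhere (inj₁ refl) Adj-closed
    adjacentEnds : ∀ {a b} → Ends a → Ends b → a ≢ b → Adj G a b
    adjacentEnds (inj₁ refl) (inj₁ refl) a≢b = contradiction refl a≢b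
    adjacentEnds (inj₁ refl) (inj₂ refl) _   = ~⇒Adj uv
    adjacentEnds (inj₂ refl) (inj₁ refl) _   = ~⇒Adj (~-sym uv)
    adjacentEnds (inj₂ refl) (inj₂ refl) a≢b = contradiction refl a≢b

  leaf-~⇒Branch : ∀ {x w} → ¬ Branch x → x ~ w → Branch w
  leaf-~⇒Branch x-leaf xw = decidable-stable (branch? _) (no-leaf-edge xw x-leaf)

  -- If every H-neighbour of v were a leaf, H would be a star centred at v and G = H² complete.
  ∃~Branch : ∀ v → ∃[ x ] (v ~ x × Branch x)
  ∃~Branch v with any? (λ x → v ~? x ×-dec branch? x)
  ... | yes found = found
  ... | no none =
    let (a , b , a≢b , ¬ab) = ∃nonAdjacent
    in contradiction (N[]-isClique v a b (∈N[]⁺ (everywhere a)) (∈N[]⁺ (everywhere b)) a≢b) ¬ab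
    where
    leafNbr : ∀ {x} → v ~ x → ¬ Branch x
    leafNbr vx x-branch = none (_ , vx , x-branch)
    Adj-closed : ∀ {z z'} → z ≡ v ⊎ v ~ z → Adj G z z' → z' ≡ v ⊎ v ~ z'
    Adj-closed z∈ zz' with Adj⇒Dist≤2 zz' | z∈
    ... | _ , inj₁ z~z'           | inj₁ refl = inj₂ z~z'
    ... | _ , inj₂ (p , vp , pz') | inj₁ refl = inj₁ (leaf-~-unique (leafNbr vp) pz' (~-sym vp))
    ... | _ , inj₁ z~z'           | inj₂ vz   = inj₁ (leaf-~-unique (leafNbr vz) z~z' (~-sym vz))
    ... | _ , inj₂ (p , zp , pz') | inj₂ vz with leaf-~-unique (leafNbr vz) zp (~-sym vz)
    ...   | refl = inj₂ pz'
    everywhere : ∀ y → y ≡ v ⊎ v ~ y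
    everywhere = Adj-closed⇒everywhere (inj₁ refl) Adj-closed

  module _ {Q : Subset n} (Q-max : IsMaxClique G Q) where
    private
      Dist≤2-inQ : ∀ {u v} → u ∈ Q → v ∈ Q → u ≢ v → Dist≤2 H u v
      Dist≤2-inQ u∈ v∈ u≢v = Adj⇒Dist≤2 (proj₁ Q-max _ _ u∈ v∈ u≢v)

      ⊆N[]⇒≡ : ∀ {w} → Q ⊆ N[ w ] → Q ≡ N[ w ]
      ⊆N[]⇒≡ {w} = IsMaxClique-⊆⇒≡ Q-max (N[]-isClique w)

      ∃twoElements : ∃[ u ] ∃[ v ] (u ∈ Q × v ∈ Q × u ≢ v)
      ∃twoElements =
        let (u , u∈Q) = someElement (proj₁ ∃nonAdjacent)
            (v , v∈Q , v≢u) = otherElement u∈Q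
        in u , v , u∈Q , v∈Q , ≢-sym v≢u
        where
        someElement : Fin n → ∃[ u ] u ∈ Q
        someElement a with a ∈? Q
        ... | yes a∈Q = a , a∈Q
        ... | no a∉Q = let (u , u∈Q , _) = IsMaxClique-blocks Q-max a∉Q in u , u∈Q
        otherElement : ∀ {u} → u ∈ Q → ∃[ v ] (v ∈ Q × v ≢ u)
        otherElement {u} u∈Q with ∃Adj u
        ... | y , uy with y ∈? Q
        ...   | yes y∈Q = y , y∈Q , ≢-sym (Adj⇒≢ uy)
        ...   | no y∉Q = let (x , x∈Q , _ , ¬xy) = IsMaxClique-blocks Q-max y∉Q
                         in x , x∈Q , λ { refl → ¬xy uy }

    -- A vertex of Q outside N[w] would close a cycle of length at most 6 with u, w and v.
    ~~⇒⊆N[] : ∀ {u v w} → u ∈ Q → v ∈ Q → u ≢ v → u ~ w → w ~ v → Q ⊆ N[ w ]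
    ~~⇒⊆N[] {u} {v} {w} u∈Q v∈Q u≢v uw wv {z} z∈Q = decidable-stable (z ∈? N[ w ]) outside
      where
      outside : z ∉ N[ w ] → ⊥
      outside z∉ = distances (Dist≤2-inQ z∈Q u∈Q z≢u) (Dist≤2-inQ z∈Q v∈Q z≢v)
        where
        z≢w = ∉N[]⇒≢ z∉
        w≁z = ∉N[]⇒≁ z∉
        z≢u : z ≢ u
        z≢u refl = z∉ (~⇒∈N[] (~-sym uw))
        z≢v : z ≢ v
        z≢v refl = z∉ (~⇒∈N[] wv)
        distances : Dist≤2 H z u → Dist≤2 H z v → ⊥
        distances (_ , inj₁ zu) (_ , inj₁ zv) = no-4-cycle zu uw wv (~-sym zv) z≢w u≢v
        distances (_ , inj₁ zu) (_ , inj₂ (q , zq , qv)) =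
          no-5-cycle zu uw wv (~-sym qv) (~-sym zq) z≢w u≢v
            (λ { refl → w≁z (~-sym zq) }) (≢-sym z≢v)
            (λ { refl → no-triangle uw wv (~-sym qv) })
        distances (_ , inj₂ (p , zp , pu)) (_ , inj₁ zv) =
          no-5-cycle zv (~-sym wv) (~-sym uw) (~-sym pu) (~-sym zp) z≢w (≢-sym u≢v)
            (λ { refl → w≁z (~-sym zp) }) (≢-sym z≢u)
            (λ { refl → no-triangle (~-sym wv) (~-sym uw) (~-sym pu) })
        distances (_ , inj₂ (p , zp , pu)) (_ , inj₂ (q , zq , qv)) =
          no-6-cycle zp pu uw wv (~-sym qv) (~-sym zq) z≢u
            (λ { refl → w≁z (~-sym zp) }) u≢v (λ { refl → w≁z (~-sym zq) }) (≢-sym z≢v) q≢p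
          where
          q≢p : q ≢ p
          q≢p refl = no-4-cycle pu uw wv (~-sym qv) (λ { refl → w≁z (~-sym zp) }) u≢v

    ~⇒far~ : ∀ {a b z} → a ~ b → a ∈ Q → b ∈ Q → z ∈ Q → z ∉ N[ a ] → b ~ z
    ~⇒far~ {a} {b} {z} ab a∈Q b∈Q z∈Q z∉ with Dist≤2-inQ z∈Q a∈Q (∉N[]⇒≢ z∉)
    ... | _ , inj₁ za = contradiction (~-sym za) (∉N[]⇒≁ z∉)
    ... | _ , inj₂ (p , zp , pa) with p ≟ᶠ b
    ...   | yes refl = ~-sym zp
    ...   | no p≢b with Dist≤2-inQ z∈Q b∈Q (λ { refl → z∉ (~⇒∈N[] ab) })
    ...     | _ , inj₁ zb = ⊥-elim (no-4-cycle zp pa ab (~-sym zb) (∉N[]⇒≢ z∉) p≢b)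
    ...     | _ , inj₂ (q , zq , qb) = ⊥-elim
                (no-5-cycle zp pa ab (~-sym qb) (~-sym zq) (∉N[]⇒≢ z∉) p≢b
                  (λ { refl → ∉N[]⇒≁ z∉ (~-sym zq) }) (λ { refl → z∉ (~⇒∈N[] ab) })
                  (λ { refl → no-triangle pa ab (~-sym qb) }))

    -- A vertex y of Q outside N[v] is H-adjacent to u, and then y, u, v, z lie on a 4- or 5-cycle.
    ~-escape⇒⊆N[] : ∀ {u v z} → u ∈ Q → v ∈ Q → u ~ v → z ∈ Q → z ∉ N[ u ] → Q ⊆ N[ v ]
    ~-escape⇒⊆N[] {u} {v} {z} u∈Q v∈Q uv z∈Q z∉ {y} y∈Q = decidable-stable (y ∈? N[ v ]) outside
      where
      vz = ~⇒far~ uv u∈Q v∈Q z∈Q z∉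
      outside : y ∉ N[ v ] → ⊥
      outside y∉ with Dist≤2-inQ y∈Q z∈Q (λ { refl → y∉ (~⇒∈N[] vz) })
      ... | _ , inj₁ yz = no-4-cycle (~-sym uy) uv vz (~-sym yz) (∉N[]⇒≢ y∉) (λ { refl → z∉ self∈N[] })
        where uy = ~⇒far~ (~-sym uv) v∈Q u∈Q y∈Q y∉
      ... | _ , inj₂ (r , yr , rz) =
        no-5-cycle (~-sym uy) uv vz (~-sym rz) (~-sym yr) (∉N[]⇒≢ y∉) (λ { refl → z∉ self∈N[] })
          (λ { refl → ∉N[]⇒≁ y∉ (~-sym yr) }) (λ { refl → y∉ (~⇒∈N[] vz) })
          (λ { refl → ∉N[]⇒≁ z∉ rz })
        where uy = ~⇒far~ (~-sym uv) v∈Q u∈Q y∈Q y∉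

    -- Q ⊆ N[u] = {u, v} forces N[v] ⊆ Q by maximality, so v would be a leaf as well.
    ⊆N[leaf]⇒⊥ : ∀ {u v} → u ~ v → Q ⊆ N[ u ] → ¬ Branch u → ⊥
    ⊆N[leaf]⇒⊥ {u} {v} uv Q⊆N[u] u-leaf = no-leaf-edge uv u-leaf v-leaf
      where
      N[v]⊆Q : N[ v ] ⊆ Q
      N[v]⊆Q = proj₂ Q-max N[ v ] (N[]-isClique v) λ y∈Q →
        [ (λ { refl → ~⇒∈N[] (~-sym uv) })
        , (λ uy → subst (_∈ N[ v ]) (sym (leaf-~-unique u-leaf uy uv)) self∈N[]) ]′ (∈N[]⁻ (Q⊆N[u] y∈Q))
      onlyU : ∀ {x} → v ~ x → x ≡ u
      onlyU vx with ∈N[]⁻ (Q⊆N[u] (N[v]⊆Q (~⇒∈N[] vx)))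
      ... | inj₁ x≡u = x≡u
      ... | inj₂ ux = ⊥-elim (~-irrefl (subst (v ~_) (leaf-~-unique u-leaf ux uv) vx))
      v-leaf : ¬ Branch v
      v-leaf (x , y , x≢y , vx , vy) = x≢y (trans (onlyU vx) (sym (onlyU vy)))

    ~⇒centre : ∀ {u v} → u ∈ Q → v ∈ Q → u ~ v → ∃[ c ] (Branch c × Q ≡ N[ c ])
    ~⇒centre {u} {v} u∈Q v∈Q uv with ⊆⊎∃∉ Q N[ u ]
    ... | inj₂ (z , z∈Q , z∉) =
      v , (u , z , (λ { refl → z∉ self∈N[] }) , ~-sym uv , ~⇒far~ uv u∈Q v∈Q z∈Q z∉) ,
      ⊆N[]⇒≡ (~-escape⇒⊆N[] u∈Q v∈Q uv z∈Q z∉)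
    ... | inj₁ Q⊆N[u] with branch? u
    ...   | yes u-branch = u , u-branch , ⊆N[]⇒≡ Q⊆N[u]
    ...   | no u-leaf = ⊥-elim (⊆N[leaf]⇒⊥ uv Q⊆N[u] u-leaf)

    maxClique≡N[] : ∃[ c ] (Branch c × Q ≡ N[ c ])
    maxClique≡N[] with ∃twoElements
    ... | u , v , u∈Q , v∈Q , u≢v with Dist≤2-inQ u∈Q v∈Q u≢v
    ...   | _ , inj₁ uv = ~⇒centre u∈Q v∈Q uv
    ...   | _ , inj₂ (w , uw , wv) =
      w , (u , v , u≢v , ~-sym uw , wv) , ⊆N[]⇒≡ (~~⇒⊆N[] u∈Q v∈Q u≢v uw wv)

  N[]-~-≢ : ∀ {u v} → Branch u → u ~ v → N[ u ] ≢ N[ v ]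
  N[]-~-≢ {u} {v} u-branch uv N[u]≡N[v] with Branch⇒~≢ u-branch v
  ... | r , ur , r≢v with ∈N[]⁻ (subst (r ∈_) N[u]≡N[v] (~⇒∈N[] ur))
  ...   | inj₁ r≡v = r≢v r≡v
  ...   | inj₂ vr = no-triangle uv vr (~-sym ur)

  ~⇒Forced : ∀ {u v} → u ~ v → Branch u → Branch v → Forced G u v
  ~⇒Forced uv u-branch v-branch =
    ~⇒Adj uv , N[ _ ] , N[ _ ] , N[]-~-≢ u-branch uv , N[]-isMaxClique u-branch , N[]-isMaxClique v-branch ,
    self∈N[] , ~⇒∈N[] uv , ~⇒∈N[] (~-sym uv) , self∈N[]

  private
    -- Two distinct vertices in two distinct closed neighbourhoods are their centres, or a 3- or 4-cycle appears.
    ∈N[]∩N[]⇒~ : ∀ {u v a b} → u ≢ v → a ≢ b → Branch a → Branch b →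
                 u ≡ a ⊎ a ~ u → v ≡ a ⊎ a ~ v → u ≡ b ⊎ b ~ u → v ≡ b ⊎ b ~ v →
                 u ~ v × Branch u × Branch v
    ∈N[]∩N[]⇒~ u≢v a≢b a-br b-br (inj₁ refl) (inj₁ refl) _ _ = contradiction refl u≢v
    ∈N[]∩N[]⇒~ u≢v a≢b a-br b-br (inj₁ refl) (inj₂ av) (inj₁ refl) _ = contradiction refl a≢b
    ∈N[]∩N[]⇒~ u≢v a≢b a-br b-br (inj₁ refl) (inj₂ av) (inj₂ bu) (inj₁ refl) = av , a-br , b-br
    ∈N[]∩N[]⇒~ u≢v a≢b a-br b-br (inj₁ refl) (inj₂ av) (inj₂ bu) (inj₂ bv) = ⊥-elim (no-triangle av (~-sym bv) bu)
    ∈N[]∩N[]⇒~ u≢v a≢b a-br b-br (inj₂ au) (inj₁ refl) _ (inj₁ refl) = contradiction refl a≢b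
    ∈N[]∩N[]⇒~ u≢v a≢b a-br b-br (inj₂ au) (inj₁ refl) (inj₁ refl) (inj₂ bv) = bv , b-br , a-br
    ∈N[]∩N[]⇒~ u≢v a≢b a-br b-br (inj₂ au) (inj₁ refl) (inj₂ bu) (inj₂ bv) = ⊥-elim (no-triangle au (~-sym bu) bv)
    ∈N[]∩N[]⇒~ u≢v a≢b a-br b-br (inj₂ au) (inj₂ av) (inj₁ refl) (inj₁ refl) = contradiction refl u≢v
    ∈N[]∩N[]⇒~ u≢v a≢b a-br b-br (inj₂ au) (inj₂ av) (inj₁ refl) (inj₂ bv) = ⊥-elim (no-triangle au bv (~-sym av))
    ∈N[]∩N[]⇒~ u≢v a≢b a-br b-br (inj₂ au) (inj₂ av) (inj₂ bu) (inj₁ refl) = ⊥-elim (no-triangle av bu (~-sym au))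
    ∈N[]∩N[]⇒~ u≢v a≢b a-br b-br (inj₂ au) (inj₂ av) (inj₂ bu) (inj₂ bv) =
      ⊥-elim (no-4-cycle (~-sym au) av (~-sym bv) bu u≢v a≢b)

  Forced⇒~ : ∀ {u v} → Forced G u v → u ~ v × Branch u × Branch v
  Forced⇒~ (uv , Q₁ , Q₂ , Q₁≢Q₂ , max₁ , max₂ , u∈₁ , v∈₁ , u∈₂ , v∈₂)
    with maxClique≡N[] max₁ | maxClique≡N[] max₂
  ... | a , a-branch , refl | b , b-branch , refl =
    ∈N[]∩N[]⇒~ (Adj⇒≢ uv) (λ { refl → Q₁≢Q₂ refl }) a-branch b-branch
      (∈N[]⁻ u∈₁) (∈N[]⁻ v∈₁) (∈N[]⁻ u∈₂) (∈N[]⁻ v∈₂)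

  InVF⇒Branch : ∀ {v} → InVF G v → Branch v
  InVF⇒Branch (_ , f) = proj₁ (proj₂ (Forced⇒~ f))

  Branch⇒InVF : ∀ {v} → Branch v → InVF G v
  Branch⇒InVF v-branch =
    let (x , vx , x-branch) = ∃~Branch _ in x , ~⇒Forced vx v-branch x-branch

  condI : CondI G
  condI v v∉VF with ∃~ v
  ... | w , vw = N[ w ] , N[]-isMaxClique (leaf-~⇒Branch v-leaf vw) , ~⇒∈N[] (~-sym vw) , unique
    where
    v-leaf : ¬ Branch v
    v-leaf = v∉VF ∘ Branch⇒InVF
    unique : ∀ Q → IsMaxClique G Q → v ∈ Q → Q ≡ N[ w ]
    unique Q Q-max v∈Q with maxClique≡N[] Q-max
    ... | a , a-branch , refl with ∈N[]⁻ v∈Q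
    ...   | inj₁ refl = contradiction a-branch v-leaf
    ...   | inj₂ av = cong N[_] (leaf-~-unique v-leaf (~-sym av) vw)

  condII : CondII G
  condII u v f with Forced⇒~ f
  ... | uv , u-branch , v-branch =
    N[ u ] , N[ v ] , N[]-~-≢ u-branch uv ,
    N[]-isMaxClique u-branch , self∈N[] , ~⇒∈N[] uv ,
    N[]-isMaxClique v-branch , ~⇒∈N[] (~-sym uv) , self∈N[] , onlyTwo
    where
    onlyTwo : ∀ Q → IsMaxClique G Q → u ∈ Q → v ∈ Q → Q ≡ N[ u ] ⊎ Q ≡ N[ v ]
    onlyTwo Q Q-max u∈Q v∈Q with maxClique≡N[] Q-max
    ... | a , _ , refl with ∈N[]⁻ u∈Q | ∈N[]⁻ v∈Q
    ...   | inj₁ refl | _         = inj₁ refl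
    ...   | inj₂ _    | inj₁ refl = inj₂ refl
    ...   | inj₂ au   | inj₂ av   = ⊥-elim (no-triangle au uv (~-sym av))

  condIII : CondIII G
  condIII u v w uv vw with Forced⇒~ uv | Forced⇒~ vw
  ... | u~v , _ , v-branch | v~w , _ , _ =
    N[ v ] , N[]-isMaxClique v-branch , ~⇒∈N[] (~-sym u~v) , self∈N[] , ~⇒∈N[] v~w

  condIV : CondIV G
  condIV Q Q-max with maxClique≡N[] Q-max
  ... | w , w-branch , refl with ∃~Branch w
  ...   | x , wx , x-branch =
    w , (self∈N[] , Branch⇒InVF w-branch) ,
    (x , (~⇒∈N[] wx , Branch⇒InVF x-branch) , ≢-sym (~⇒≢ wx)) ,
    centre-forced , leaves-unforced
    where
    ∈N[]⇒~ : ∀ {x} → x ∈ N[ w ] → x ≢ w → w ~ x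
    ∈N[]⇒~ x∈ x≢w = [ (λ x≡w → contradiction x≡w x≢w) , (λ wx → wx) ]′ (∈N[]⁻ x∈)
    centre-forced : ∀ x → x ∈ N[ w ] × InVF G x → x ≢ w → Forced G w x
    centre-forced x (x∈ , x∈VF) x≢w = ~⇒Forced (∈N[]⇒~ x∈ x≢w) w-branch (InVF⇒Branch x∈VF)
    leaves-unforced : ∀ x y → x ∈ N[ w ] × InVF G x → y ∈ N[ w ] × InVF G y → x ≢ w → y ≢ w → ¬ Forced G x y
    leaves-unforced x y (x∈ , _) (y∈ , _) x≢w y≢w xy =
      no-triangle (∈N[]⇒~ x∈ x≢w) (proj₁ (Forced⇒~ xy)) (~-sym (∈N[]⇒~ y∈ y≢w))

  Anchor : Fin n → Fin n → Set
  Anchor x a = Branch a × (a ≡ x ⊎ (¬ Branch x × x ~ a))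

  anchor : ∀ x → ∃ (Anchor x)
  anchor x with branch? x
  ... | yes x-branch = x , x-branch , inj₁ refl
  ... | no x-leaf = let (w , xw) = ∃~ x in w , leaf-~⇒Branch x-leaf xw , inj₂ (x-leaf , xw)

  Anchor-unique : ∀ {x a b} → Anchor x a → Anchor x b → a ≡ b
  Anchor-unique (_ , inj₁ refl) (_ , inj₁ refl) = refl
  Anchor-unique (a-branch , inj₁ refl) (_ , inj₂ (x-leaf , _)) = contradiction a-branch x-leaf
  Anchor-unique (_ , inj₂ (x-leaf , _)) (b-branch , inj₁ refl) = contradiction b-branch x-leaf
  Anchor-unique (_ , inj₂ (x-leaf , xa)) (_ , inj₂ (_ , xb)) = leaf-~-unique x-leaf xa xb

  Anchor-~ : ∀ {x a p} → Anchor x a → x ~ p → Branch p → Reach (Forced G) a p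
  Anchor-~ (a-branch , inj₁ refl) xp p-branch = step (~⇒Forced xp a-branch p-branch) here
  Anchor-~ (_ , inj₂ (x-leaf , xa)) xp _ = subst (λ a → Reach (Forced G) a _) (leaf-~-unique x-leaf xp xa) here

  Adj⇒anchorsLinked : ∀ {x y a b} → Adj G x y → Anchor x a → Anchor y b → Reach (Forced G) a b
  Adj⇒anchorsLinked {x} {y} xy anchor-x anchor-y with Adj⇒Dist≤2 xy
  ... | x≢y , inj₂ (p , xp , py) =
    Reach-trans (Anchor-~ anchor-x xp p-branch) (Reach-sym Forced-sym (Anchor-~ anchor-y (~-sym py) p-branch))
    where
    p-branch : Branch p
    p-branch = x , y , x≢y , ~-sym xp , py
  ... | _ , inj₁ x~y with anchor-x | anchor-y
  ...   | x-branch , inj₁ refl | y-branch , inj₁ refl = step (~⇒Forced x~y x-branch y-branch) here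
  ...   | _ , inj₁ refl | _ , inj₂ (y-leaf , yb) =
    subst (Reach (Forced G) x) (leaf-~-unique y-leaf (~-sym x~y) yb) here
  ...   | _ , inj₂ (x-leaf , xa) | _ , inj₁ refl =
    subst (λ a → Reach (Forced G) a y) (leaf-~-unique x-leaf x~y xa) here
  ...   | _ , inj₂ (x-leaf , _) | _ , inj₂ (y-leaf , _) = ⊥-elim (no-leaf-edge x~y x-leaf y-leaf)

  Reach⇒anchorsLinked : ∀ {x y a b} → Reach (Adj G) x y → Anchor x a → Anchor y b → Reach (Forced G) a b
  Reach⇒anchorsLinked here anchor-a anchor-b = subst (Reach (Forced G) _) (Anchor-unique anchor-a anchor-b) here
  Reach⇒anchorsLinked (step {v = m} xm rest) anchor-a anchor-b =
    Reach-trans (Adj⇒anchorsLinked xm anchor-a (proj₂ (anchor m))) (Reach⇒anchorsLinked rest (proj₂ (anchor m)) anchor-b)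

  condV : CondV G
  condV = (λ u v u∈VF v∈VF → Reach⇒anchorsLinked (connected u v) (InVF⇒Branch u∈VF , inj₁ refl) (InVF⇒Branch v∈VF , inj₁ refl))
        , GirthAtLeast7-mono (proj₁ ∘ Forced⇒~) girth

module Hubs {n : ℕ} (G : SimpleGraph n) (condII : CondII G) (condIII : CondIII G) (condIV : CondIV G)
            (F-girth : GirthAtLeast7 (Forced G)) where
  open Cliques G
  open ForcedEdges G
  open ShortCycles (Forced G) Forced-irrefl F-girth using () renaming (no-triangle to no-forced-triangle)

  Through : Fin n → Fin n → Subset n → Set
  Through a b Q = IsMaxClique G Q × a ∈ Q × b ∈ Q

  Through-sym : ∀ {a b Q} → Through a b Q → Through b a Q
  Through-sym (Q-max , a∈Q , b∈Q) = Q-max , b∈Q , a∈Q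

  Forced-pigeonhole : ∀ {a b Q₀ Q Q'} → Forced G a b → Through a b Q₀ → Through a b Q → Through a b Q' →
                      Q ≢ Q₀ → Q' ≢ Q₀ → Q ≡ Q'
  Forced-pigeonhole {a} {b} {Q₀} {Q} {Q'} ab (max₀ , a∈₀ , b∈₀) (max , a∈ , b∈) (max' , a∈' , b∈') Q≢Q₀ Q'≢Q₀
    with condII a b ab
  ... | _ , _ , _ , _ , _ , _ , _ , _ , _ , onlyTwo =
    among (onlyTwo Q₀ max₀ a∈₀ b∈₀) (onlyTwo Q max a∈ b∈) (onlyTwo Q' max' a∈' b∈')
    where
    among : ∀ {Q₁ Q₂} → Q₀ ≡ Q₁ ⊎ Q₀ ≡ Q₂ → Q ≡ Q₁ ⊎ Q ≡ Q₂ → Q' ≡ Q₁ ⊎ Q' ≡ Q₂ → Q ≡ Q'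
    among (inj₁ refl) (inj₁ refl) _ = contradiction refl Q≢Q₀
    among (inj₂ refl) (inj₂ refl) _ = contradiction refl Q≢Q₀
    among _ (inj₁ refl) (inj₁ refl) = refl
    among _ (inj₂ refl) (inj₂ refl) = refl
    among (inj₁ refl) (inj₂ refl) (inj₁ refl) = contradiction refl Q'≢Q₀
    among (inj₂ refl) (inj₁ refl) (inj₂ refl) = contradiction refl Q'≢Q₀

  record Hub (Q : Subset n) (t : Fin n) : Set where
    field
      ∈Q        : t ∈ Q
      inVF      : InVF G t
      forced-to : ∀ z → z ∈ Q → InVF G z → z ≢ t → Forced G t z
      closed    : ∀ z → Forced G t z → z ∈ Q

  -- When the F-edge cy leaves Q, the star F[Q ∩ V_F] is the single edge cx: another leaf z would make xz
  -- forced, through Q and through a clique containing y. And x is a hub: an F-edge xz leaving Q would put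
  -- the path y c x z into one maximal clique, against (iv).
  escape⇒leaf-Hub : ∀ {Q c x y} → IsMaxClique G Q → c ∈ Q → InVF G c → x ∈ Q → InVF G x → x ≢ c →
                    (∀ z → z ∈ Q × InVF G z → z ≢ c → Forced G c z) → Forced G c y → y ∉ Q → Hub Q x
  escape⇒leaf-Hub {Q} {c} {x} {y} Q-max c∈Q c∈VF x∈Q x∈VF x≢c centre-forced cy y∉Q = record
    { ∈Q = x∈Q ; inVF = x∈VF ; forced-to = x-forced-to ; closed = x-closed }
    where
    cx = centre-forced x (x∈Q , x∈VF) x≢c
    Adj-y : ∀ {p} → p ∈ Q → Forced G c p → Adj G p y
    Adj-y p∈Q cp with condIII _ c y (Forced-sym cp) cy
    ... | Q' , (Q'-clique , _) , p∈Q' , _ , y∈Q' = Q'-clique _ y p∈Q' y∈Q' (λ { refl → y∉Q p∈Q })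
    onlyLeaf : ∀ z → z ∈ Q → InVF G z → z ≢ c → z ≡ x
    onlyLeaf z z∈Q z∈VF z≢c with z ≟ᶠ x
    ... | yes z≡x = z≡x
    ... | no z≢x = ⊥-elim (no-forced-triangle cx xz (Forced-sym cz))
      where
      cz = centre-forced z (z∈Q , z∈VF) z≢c
      xz : Forced G x z
      xz with maxClique-⊇ (x ∷ˡ z ∷ˡ c ∷ˡ y ∷ˡ []ˡ)
                ((proj₁ Q-max x z x∈Q z∈Q ∷ const (proj₁ (Forced-sym cx)) ∷ const (Adj-y x∈Q cx) ∷ []) ∷
                 (const (proj₁ (Forced-sym cz)) ∷ const (Adj-y z∈Q cz) ∷ []) ∷ (const (proj₁ cy) ∷ []) ∷ [] ∷ [])
      ... | Q* , Q*-max , x∈* ∷ z∈* ∷ _ ∷ y∈* ∷ [] =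
        proj₁ Q-max x z x∈Q z∈Q (≢-sym z≢x) , Q , Q* , (λ { refl → y∉Q y∈* }) ,
        Q-max , Q*-max , x∈Q , z∈Q , x∈* , z∈*
    x-forced-to : ∀ z → z ∈ Q → InVF G z → z ≢ x → Forced G x z
    x-forced-to z z∈Q z∈VF z≢x with z ≟ᶠ c
    ... | yes refl = Forced-sym cx
    ... | no z≢c = contradiction (onlyLeaf z z∈Q z∈VF z≢c) z≢x
    x-closed : ∀ z → Forced G x z → z ∈ Q
    x-closed z xz = decidable-stable (z ∈? Q) λ z∉Q →
      let (Qa , Qa-max , xa , ca , ya) = condIII x c y (Forced-sym cx) cy
          (Qb , Qb-max , cb , xb , zb) = condIII c x z cx xz
          Qa≡Qb = Forced-pigeonhole cx (Q-max , c∈Q , x∈Q) (Qa-max , ca , xa) (Qb-max , cb , xb)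
                    (λ Qa≡Q → y∉Q (subst (y ∈_) Qa≡Q ya)) (λ Qb≡Q → z∉Q (subst (z ∈_) Qb≡Q zb))
      in IsStarOn-no-path3 (condIV Qa Qa-max) (ya , Forced⇒InVFʳ cy) (ca , c∈VF) (xa , x∈VF)
           (subst (z ∈_) (sym Qa≡Qb) zb , Forced⇒InVFʳ xz) (Forced-sym cy) cx xz
           (λ { refl → y∉Q x∈Q }) (≢-sym x≢c) (λ { refl → z∉Q c∈Q })

  ∃Hub : ∀ {Q} → IsMaxClique G Q → ∃ (Hub Q)
  ∃Hub {Q} Q-max with condIV Q Q-max
  ... | c , (c∈Q , c∈VF) , (x , (x∈Q , x∈VF) , x≢c) , centre-forced , _
    with any? (λ y → forced? c y ×-dec ¬? (y ∈? Q))
  ... | yes (y , cy , y∉Q) = x , escape⇒leaf-Hub Q-max c∈Q c∈VF x∈Q x∈VF x≢c centre-forced cy y∉Q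
  ... | no none = c , record
    { ∈Q = c∈Q ; inVF = c∈VF
    ; forced-to = λ z z∈Q z∈VF z≢c → centre-forced z (z∈Q , z∈VF) z≢c
    ; closed = λ z cz → decidable-stable (z ∈? Q) (λ z∉Q → none (z , cz , z∉Q)) }

  Isolated : Fin n → Fin n → Set
  Isolated t x = Forced G t x × (∀ y → Forced G t y → y ≡ x) × (∀ y → Forced G x y → y ≡ t)

  isolated? : ∀ t x → Dec (Isolated t x)
  isolated? t x = forced? t x ×-dec all? (λ y → forced? t y →-dec y ≟ᶠ x) ×-dec all? (λ y → forced? x y →-dec y ≟ᶠ t)

  Isolated-sym : ∀ {t x} → Isolated t x → Isolated x t
  Isolated-sym (tx , only-x , only-t) = Forced-sym tx , only-t , only-x

  Isolated-unique : ∀ {t x x'} → Isolated t x → Isolated t x' → x ≡ x'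
  Isolated-unique (tx , _) (_ , only-x' , _) = only-x' _ tx

  Isolated-Hub : ∀ {Q t x} → Hub Q t → Isolated t x → Hub Q x
  Isolated-Hub {Q} {t} {x} t-hub (tx , only-x , only-t) = record
    { ∈Q = closed x tx ; inVF = Forced⇒InVFʳ tx ; forced-to = x-forced-to
    ; closed = λ z xz → subst (_∈ Q) (sym (only-t z xz)) ∈Q }
    where
    open Hub t-hub
    x-forced-to : ∀ z → z ∈ Q → InVF G z → z ≢ x → Forced G x z
    x-forced-to z z∈Q z∈VF z≢x with z ≟ᶠ t
    ... | yes refl = Forced-sym tx
    ... | no z≢t = contradiction (only-x z (forced-to z z∈Q z∈VF z≢t)) z≢x

  Hub-unique : ∀ {Q t t'} → Hub Q t → Hub Q t' → t ≢ t' → Isolated t t'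
  Hub-unique {Q} {t} {t'} t-hub t'-hub t≢t' = tt' , only t-hub t'-hub tt' , only t'-hub t-hub (Forced-sym tt')
    where
    tt' = Hub.forced-to t-hub t' (Hub.∈Q t'-hub) (Hub.inVF t'-hub) (≢-sym t≢t')
    only : ∀ {a b} → Hub Q a → Hub Q b → Forced G a b → ∀ y → Forced G a y → y ≡ b
    only {b = b} a-hub b-hub ab y ay with y ≟ᶠ b
    ... | yes y≡b = y≡b
    ... | no y≢b = ⊥-elim (no-forced-triangle ab (Hub.forced-to b-hub y (Hub.closed a-hub y ay) (Forced⇒InVFʳ ay) y≢b)
                                              (Forced-sym ay))

  Hub-shared : ∀ {Q Q' t} → IsMaxClique G Q → IsMaxClique G Q' → Q ≢ Q' → Hub Q t → Hub Q' t → ∃ (Isolated t)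
  Hub-shared {Q} {Q'} {t} Q-max Q'-max Q≢Q' t-hub t-hub' with Hub.inVF t-hub
  ... | u , tu = u , tu , only-u , only-t
    where
    open Hub t-hub
    open Hub t-hub' using () renaming (∈Q to ∈Q'; forced-to to forced-to'; closed to closed')
    only-u : ∀ y → Forced G t y → y ≡ u
    only-u y ty with y ≟ᶠ u
    ... | yes y≡u = y≡u
    ... | no y≢u = ⊥-elim (no-forced-triangle tu uy (Forced-sym ty))
      where
      uy : Forced G u y
      uy = proj₁ Q-max u y (closed u tu) (closed y ty) (≢-sym y≢u) , Q , Q' , Q≢Q' , Q-max , Q'-max ,
           closed u tu , closed y ty , closed' u tu , closed' y ty
    only-t : ∀ y → Forced G u y → y ≡ t
    only-t y uy with y ≟ᶠ t
    ... | yes y≡t = y≡t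
    ... | no y≢t with condIII t u y tu uy
    ...   | Qc , Qc-max , t∈c , u∈c , y∈c with Qc ≟ˢ Q
    ...     | yes refl = ⊥-elim (Forced-irrefl (subst (Forced G u) (only-u y (forced-to y y∈c (Forced⇒InVFʳ uy) y≢t)) uy))
    ...     | no Qc≢Q with Forced-pigeonhole tu (Q-max , ∈Q , closed u tu) (Qc-max , t∈c , u∈c)
                                              (Q'-max , ∈Q' , closed' u tu) Qc≢Q (≢-sym Q≢Q')
    ...       | refl = ⊥-elim (Forced-irrefl (subst (Forced G u) (only-u y (forced-to' y y∈c (Forced⇒InVFʳ uy) y≢t)) uy))

  sorted : Fin n → Fin n → Fin n × Fin n
  sorted t x with <-cmp t x
  ... | tri> _ _ _ = x , t
  ... | _          = t , x

  sorted-cases : ∀ t x → sorted t x ≡ (t , x) ⊎ sorted t x ≡ (x , t)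
  sorted-cases t x with <-cmp t x
  ... | tri< _ _ _ = inj₁ refl
  ... | tri≈ _ _ _ = inj₁ refl
  ... | tri> _ _ _ = inj₂ refl

  sorted-comm : ∀ {t x} → t ≢ x → sorted t x ≡ sorted x t
  sorted-comm {t} {x} t≢x with <-cmp t x | <-cmp x t
  ... | tri< _ _ _   | tri> _ _ _   = refl
  ... | tri> _ _ _   | tri< _ _ _   = refl
  ... | tri< t<x _ _ | tri< x<t _ _ = contradiction x<t (<-asym t<x)
  ... | tri> _ _ x<t | tri> _ _ t<x = contradiction x<t (<-asym t<x)
  ... | tri≈ _ t≡x _ | _            = contradiction t≡x t≢x
  ... | _            | tri≈ _ x≡t _ = contradiction (sym x≡t) t≢x

  -- one of the two maximal cliques through a forced edge ab; an arbitrary subset otherwise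
  designated : Fin n → Fin n → Subset n
  designated a b with forced? a b
  ... | yes ab = proj₁ (condII a b ab)
  ... | no _   = ⁅ a ⁆

  designated-Through : ∀ {a b} → Forced G a b → Through a b (designated a b)
  designated-Through {a} {b} ab with forced? a b
  ... | no ¬ab = contradiction ab ¬ab
  ... | yes ab' with condII a b ab'
  ...   | _ , _ , _ , Q₁-max , a∈Q₁ , b∈Q₁ , _ = Q₁-max , a∈Q₁ , b∈Q₁

  -- For an isolated edge ab, the hub a is used for the designated clique and b for the other one.
  pick : Fin n × Fin n → Subset n → Fin n
  pick (a , b) Q with Q ≟ˢ designated a b
  ... | yes _ = a
  ... | no _  = b

  pick-cases : ∀ a b Q → pick (a , b) Q ≡ a ⊎ pick (a , b) Q ≡ b
  pick-cases a b Q with Q ≟ˢ designated a b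
  ... | yes _ = inj₁ refl
  ... | no _  = inj₂ refl

  pick-injective : ∀ {a b Q Q'} → Forced G a b → Through a b Q → Through a b Q' →
                   pick (a , b) Q ≡ pick (a , b) Q' → Q ≡ Q'
  pick-injective {a} {b} {Q} {Q'} ab through through' same
    with Q ≟ˢ designated a b | Q' ≟ˢ designated a b
  ... | yes Q≡d | yes Q'≡d = trans Q≡d (sym Q'≡d)
  ... | yes _   | no _     = contradiction same (Forced⇒≢ ab)
  ... | no _    | yes _    = contradiction (sym same) (Forced⇒≢ ab)
  ... | no Q≢d  | no Q'≢d  = Forced-pigeonhole ab (designated-Through ab) through through' Q≢d Q'≢d

  pick-sorted-cases : ∀ t x Q → pick (sorted t x) Q ≡ t ⊎ pick (sorted t x) Q ≡ x
  pick-sorted-cases t x Q with sorted-cases t x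
  ... | inj₁ eq rewrite eq = pick-cases t x Q
  ... | inj₂ eq rewrite eq = [ inj₂ , inj₁ ]′ (pick-cases x t Q)

  pick-sorted-injective : ∀ {t x Q Q'} → Forced G t x → Through t x Q → Through t x Q' →
                          pick (sorted t x) Q ≡ pick (sorted t x) Q' → Q ≡ Q'
  pick-sorted-injective {t} {x} tx through through' same with sorted-cases t x
  ... | inj₁ eq rewrite eq = pick-injective tx through through' same
  ... | inj₂ eq rewrite eq = pick-injective (Forced-sym tx) (Through-sym through) (Through-sym through') same

  -- the parent in H of the vertices of Q outside V_F, computed from any hub t of Q
  private
    centreBy : Subset n → (t : Fin n) → Dec (∃ (Isolated t)) → Fin n
    centreBy Q t (yes (x , _)) = pick (sorted t x) Q
    centreBy Q t (no _)        = t

  centre : Subset n → Fin n → Fin n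
  centre Q t = centreBy Q t (any? (isolated? t))

  centre-isolated : ∀ {Q t x} → Isolated t x → centre Q t ≡ pick (sorted t x) Q
  centre-isolated {Q} {t} {x} tx = by (any? (isolated? t))
    where
    by : (d : Dec (∃ (Isolated t))) → centreBy Q t d ≡ pick (sorted t x) Q
    by (yes (x' , tx')) = cong (λ z → pick (sorted t z) Q) (Isolated-unique tx' tx)
    by (no none) = contradiction (_ , tx) none

  centre-Hub : ∀ {Q t} → Hub Q t → Hub Q (centre Q t)
  centre-Hub {Q} {t} t-hub = by (any? (isolated? t))
    where
    by : (d : Dec (∃ (Isolated t))) → Hub Q (centreBy Q t d)
    by (no _) = t-hub
    by (yes (x , tx)) with pick-sorted-cases t x Q
    ... | inj₁ eq = subst (Hub Q) (sym eq) t-hub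
    ... | inj₂ eq = subst (Hub Q) (sym eq) (Isolated-Hub t-hub tx)

  centre-irrelevant : ∀ {Q t t'} → Hub Q t → Hub Q t' → centre Q t ≡ centre Q t'
  centre-irrelevant {Q} {t} {t'} t-hub t'-hub with t ≟ᶠ t'
  ... | yes refl = refl
  ... | no t≢t' = begin
    centre Q t               ≡⟨ centre-isolated tt' ⟩
    pick (sorted t t') Q     ≡⟨ cong (λ p → pick p Q) (sorted-comm t≢t') ⟩
    pick (sorted t' t) Q     ≡⟨ centre-isolated (Isolated-sym tt') ⟨
    centre Q t'              ∎
    where
    open ≡-Reasoning
    tt' = Hub-unique t-hub t'-hub t≢t'

  centre-injective : ∀ {Q Q' t t'} → IsMaxClique G Q → IsMaxClique G Q' → Hub Q t → Hub Q' t' →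
                     centre Q t ≡ centre Q' t' → Q ≡ Q'
  centre-injective {Q} {Q'} {t} {t'} Q-max Q'-max t-hub t'-hub same with Q ≟ˢ Q'
  ... | yes Q≡Q' = Q≡Q'
  ... | no Q≢Q' = viaIsolated (Hub-shared Q-max Q'-max Q≢Q' w-hub w-hub')
    where
    open ≡-Reasoning
    w = centre Q t
    w-hub : Hub Q w
    w-hub = centre-Hub t-hub
    w-hub' : Hub Q' w
    w-hub' = subst (Hub Q') (sym same) (centre-Hub t'-hub)
    viaIsolated : ∃ (Isolated w) → Q ≡ Q'
    viaIsolated (x , wx) =
      pick-sorted-injective (proj₁ wx)
        (Q-max , Hub.∈Q w-hub , Hub.closed w-hub x (proj₁ wx))
        (Q'-max , Hub.∈Q w-hub' , Hub.closed w-hub' x (proj₁ wx)) (begin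
          pick (sorted w x) Q   ≡⟨ centre-isolated wx ⟨
          centre Q w            ≡⟨ centre-irrelevant w-hub t-hub ⟩
          centre Q t            ≡⟨ same ⟩
          centre Q' t'          ≡⟨ centre-irrelevant t'-hub w-hub' ⟩
          centre Q' w           ≡⟨ centre-isolated wx ⟩
          pick (sorted w x) Q'  ∎)

module SquareRoot {n : ℕ} (G : SimpleGraph n) (condI : CondI G) (condII : CondII G)
                  (condIII : CondIII G) (condIV : CondIV G) (condV : CondV G) where
  open Cliques G
  open ForcedEdges G
  open Hubs G condII condIII condIV (proj₂ condV)

  record Attachment (v : Fin n) (Q : Subset n) (p : Fin n) : Set where
    field
      max    : IsMaxClique G Q
      ∈Q     : v ∈ Q
      unique : ∀ Q' → IsMaxClique G Q' → v ∈ Q' → Q' ≡ Q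
      hub    : Fin n
      isHub  : Hub Q hub
      parent≡centre : p ≡ centre Q hub

  private
    homeBy : ∀ v → Dec (InVF G v) → Subset n
    homeBy v (yes _)  = ⁅ v ⁆
    homeBy v (no v∉F) = proj₁ (condI v v∉F)

    parentBy : ∀ v → Dec (InVF G v) → Fin n
    parentBy v (yes _)  = v
    parentBy v (no v∉F) = let (Q , Q-max , _) = condI v v∉F in centre Q (proj₁ (∃Hub Q-max))

    attachmentBy : ∀ v d → ¬ InVF G v → Attachment v (homeBy v d) (parentBy v d)
    attachmentBy v (yes v∈F) v∉F = contradiction v∈F v∉F
    attachmentBy v (no v∉F) _ =
      let (Q , Q-max , v∈Q , unique) = condI v v∉F
          (t , t-hub) = ∃Hub Q-max
      in record { max = Q-max ; ∈Q = v∈Q ; unique = unique ; hub = t ; isHub = t-hub ; parent≡centre = refl }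

  home : Fin n → Subset n
  home v = homeBy v (inVF? v)

  parent : Fin n → Fin n
  parent v = parentBy v (inVF? v)

  attachment : ∀ {v} → ¬ InVF G v → Attachment v (home v) (parent v)
  attachment {v} = attachmentBy v (inVF? v)

  module _ {v : Fin n} (v∉F : ¬ InVF G v) where
    open Attachment (attachment v∉F)

    home-max : IsMaxClique G (home v)
    home-max = max

    ∈home : v ∈ home v
    ∈home = ∈Q

    home-unique : ∀ {Q} → IsMaxClique G Q → v ∈ Q → Q ≡ home v
    home-unique = unique _

    parent-Hub : Hub (home v) (parent v)
    parent-Hub = subst (Hub (home v)) (sym parent≡centre) (centre-Hub isHub)

    parent-InVF : InVF G (parent v)
    parent-InVF = Hub.inVF parent-Hub

    ≢parent : v ≢ parent v
    ≢parent v≡p = v∉F (subst (InVF G) (sym v≡p) parent-InVF)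

  home≡⇒parent≡ : ∀ {u v} (u∉F : ¬ InVF G u) (v∉F : ¬ InVF G v) → home u ≡ home v → parent u ≡ parent v
  home≡⇒parent≡ {u} {v} u∉F v∉F same = begin
    parent u                     ≡⟨ Attachment.parent≡centre au ⟩
    centre (home u) (hub au)     ≡⟨ centre-irrelevant (isHub au) (subst (λ Q → Hub Q (hub av)) (sym same) (isHub av)) ⟩
    centre (home u) (hub av)     ≡⟨ cong (λ Q → centre Q (hub av)) same ⟩
    centre (home v) (hub av)     ≡⟨ Attachment.parent≡centre av ⟨
    parent v                     ∎
    where
    open ≡-Reasoning
    open Attachment using (hub; isHub)
    au = attachment u∉F
    av = attachment v∉F

  parent≡⇒home≡ : ∀ {u v} (u∉F : ¬ InVF G u) (v∉F : ¬ InVF G v) → parent u ≡ parent v → home u ≡ home v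
  parent≡⇒home≡ u∉F v∉F same =
    centre-injective (home-max u∉F) (home-max v∉F) (Attachment.isHub au) (Attachment.isHub av)
      (trans (sym (Attachment.parent≡centre au)) (trans same (Attachment.parent≡centre av)))
    where
    au = attachment u∉F
    av = attachment v∉F

  Hangs : Fin n → Fin n → Set
  Hangs u v = ¬ InVF G u × v ≡ parent u

  Edge : Fin n → Fin n → Set
  Edge u v = Forced G u v ⊎ Hangs u v ⊎ Hangs v u

  edge? : ∀ u v → Dec (Edge u v)
  edge? u v = forced? u v ⊎-dec (¬? (inVF? u) ×-dec v ≟ᶠ parent u) ⊎-dec (¬? (inVF? v) ×-dec u ≟ᶠ parent v)

  Edge-sym : ∀ {u v} → Edge u v → Edge v u
  Edge-sym (inj₁ uv) = inj₁ (Forced-sym uv)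
  Edge-sym (inj₂ (inj₁ hangs)) = inj₂ (inj₂ hangs)
  Edge-sym (inj₂ (inj₂ hangs)) = inj₂ (inj₁ hangs)

  Edge-irrefl : ∀ {v} → ¬ Edge v v
  Edge-irrefl (inj₁ vv) = Forced-irrefl vv
  Edge-irrefl (inj₂ (inj₁ (v∉F , v≡p))) = ≢parent v∉F v≡p
  Edge-irrefl (inj₂ (inj₂ (v∉F , v≡p))) = ≢parent v∉F v≡p

  H : SimpleGraph n
  H = record
    { adj    = λ u v → isYes (edge? u v)
    ; sym    = λ u v → isYes-⇔ (edge? u v) (edge? v u) Edge-sym Edge-sym
    ; irrefl = λ v → isYes-⇔ (edge? v v) (no λ ()) Edge-irrefl ⊥-elim }

  open Cliques H using () renaming (Adj-sym to ~-sym)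

  ~⇒Edge : ∀ {u v} → Adj H u v → Edge u v
  ~⇒Edge {u} {v} = toWitness {a? = edge? u v}

  Edge⇒~ : ∀ {u v} → Edge u v → Adj H u v
  Edge⇒~ {u} {v} = fromWitness {a? = edge? u v}

  Hangs⇒Adj : ∀ {u v} → Hangs u v → Adj G u v
  Hangs⇒Adj (u∉F , refl) =
    proj₁ (home-max u∉F) _ _ (∈home u∉F) (Hub.∈Q (parent-Hub u∉F)) (≢parent u∉F)

  Edge⇒Adj : ∀ {u v} → Edge u v → Adj G u v
  Edge⇒Adj (inj₁ uv) = proj₁ uv
  Edge⇒Adj (inj₂ (inj₁ hangs)) = Hangs⇒Adj hangs
  Edge⇒Adj (inj₂ (inj₂ hangs)) = Adj-sym (Hangs⇒Adj hangs)

  -- The middle vertex of a path of length two in H is in V_F, or both ends hang from it.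
  EdgeEdge⇒Adj : ∀ {u w v} → u ≢ v → Edge u w → Edge w v → Adj G u v
  EdgeEdge⇒Adj {u} {w} {v} u≢v (inj₁ uw) (inj₁ wv) =
    let (Q , (Q-clique , _) , u∈Q , _ , v∈Q) = condIII u w v uw wv in Q-clique u v u∈Q v∈Q u≢v
  EdgeEdge⇒Adj u≢v (inj₁ uw) (inj₂ (inj₁ (w∉F , _))) = contradiction (Forced⇒InVFʳ uw) w∉F
  EdgeEdge⇒Adj u≢v (inj₁ uw) (inj₂ (inj₂ (v∉F , refl))) =
    Adj-sym (proj₁ (home-max v∉F) _ _ (∈home v∉F) (Hub.closed (parent-Hub v∉F) _ (Forced-sym uw)) (≢-sym u≢v))
  EdgeEdge⇒Adj u≢v (inj₂ (inj₁ (u∉F , refl))) (inj₁ wv) =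
    proj₁ (home-max u∉F) _ _ (∈home u∉F) (Hub.closed (parent-Hub u∉F) _ wv) u≢v
  EdgeEdge⇒Adj u≢v (inj₂ (inj₁ (u∉F , refl))) (inj₂ (inj₁ (w∉F , _))) = contradiction (parent-InVF u∉F) w∉F
  EdgeEdge⇒Adj {u} {w} {v} u≢v (inj₂ (inj₁ (u∉F , refl))) (inj₂ (inj₂ (v∉F , same))) =
    proj₁ (home-max u∉F) u v (∈home u∉F) (subst (v ∈_) (sym (parent≡⇒home≡ u∉F v∉F same)) (∈home v∉F)) u≢v
  EdgeEdge⇒Adj u≢v (inj₂ (inj₂ (w∉F , refl))) (inj₁ wv) = contradiction (Forced⇒InVFˡ wv) w∉F
  EdgeEdge⇒Adj u≢v (inj₂ (inj₂ (w∉F , refl))) (inj₂ (inj₁ (_ , v≡u))) = contradiction (sym v≡u) u≢v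
  EdgeEdge⇒Adj u≢v (inj₂ (inj₂ (w∉F , refl))) (inj₂ (inj₂ (v∉F , w≡p))) =
    contradiction (subst (InVF G) (sym w≡p) (parent-InVF v∉F)) w∉F

  Dist≤2⇒Adj : ∀ {u v} → Dist≤2 H u v → Adj G u v
  Dist≤2⇒Adj (_ , inj₁ uv) = Edge⇒Adj (~⇒Edge uv)
  Dist≤2⇒Adj (u≢v , inj₂ (_ , uw , wv)) = EdgeEdge⇒Adj u≢v (~⇒Edge uw) (~⇒Edge wv)

  Dist≤2-sym : ∀ {u v} → Dist≤2 H u v → Dist≤2 H v u
  Dist≤2-sym (u≢v , inj₁ uv) = ≢-sym u≢v , inj₁ (~-sym uv)
  Dist≤2-sym (u≢v , inj₂ (w , uw , wv)) = ≢-sym u≢v , inj₂ (w , ~-sym wv , ~-sym uw)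

  hang : ∀ {u} → ¬ InVF G u → Adj H u (parent u)
  hang u∉F = Edge⇒~ (inj₂ (inj₁ (u∉F , refl)))

  outsideVF-Dist≤2 : ∀ {u v Q} → ¬ InVF G u → IsMaxClique G Q → u ∈ Q → v ∈ Q → u ≢ v → Dist≤2 H u v
  outsideVF-Dist≤2 {u} {v} u∉F Q-max u∈Q v∈Q u≢v with home-unique u∉F Q-max u∈Q
  ... | refl = by (inVF? v)
    where
    viaParent : InVF G v → Dec (v ≡ parent u) → Dist≤2 H u v
    viaParent _ (yes v≡p) = u≢v , inj₁ (subst (Adj H u) (sym v≡p) (hang u∉F))
    viaParent v∈F (no v≢p) =
      u≢v , inj₂ (parent u , hang u∉F , Edge⇒~ (inj₁ (Hub.forced-to (parent-Hub u∉F) v v∈Q v∈F v≢p)))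
    by : Dec (InVF G v) → Dist≤2 H u v
    by (yes v∈F) = viaParent v∈F (v ≟ᶠ parent u)
    by (no v∉F) = u≢v , inj₂ (parent u , hang u∉F , subst (λ p → Adj H p v) (sym same) (~-sym (hang v∉F)))
      where
      same : parent u ≡ parent v
      same = home≡⇒parent≡ u∉F v∉F (home-unique v∉F Q-max v∈Q)

  inVF-Dist≤2 : ∀ {u v Q} → IsMaxClique G Q → u ∈ Q → v ∈ Q → InVF G u → InVF G v → u ≢ v → Dist≤2 H u v
  inVF-Dist≤2 {u} {v} {Q} Q-max u∈Q v∈Q u∈F v∈F u≢v with condIV Q Q-max
  ... | c , _ , _ , centre-forced , _ = via (u ≟ᶠ c) (v ≟ᶠ c)
    where
    c~ : ∀ {x} → x ∈ Q → InVF G x → x ≢ c → Adj H c x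
    c~ x∈Q x∈F x≢c = Edge⇒~ (inj₁ (centre-forced _ (x∈Q , x∈F) x≢c))
    via : Dec (u ≡ c) → Dec (v ≡ c) → Dist≤2 H u v
    via (yes u≡c) (yes v≡c) = contradiction (trans u≡c (sym v≡c)) u≢v
    via (yes u≡c) (no v≢c)  = u≢v , inj₁ (subst (λ z → Adj H z v) (sym u≡c) (c~ v∈Q v∈F v≢c))
    via (no u≢c)  (yes v≡c) = u≢v , inj₁ (subst (Adj H u) (sym v≡c) (~-sym (c~ u∈Q u∈F u≢c)))
    via (no u≢c)  (no v≢c)  = u≢v , inj₂ (c , ~-sym (c~ u∈Q u∈F u≢c) , c~ v∈Q v∈F v≢c)

  Adj⇒Dist≤2 : ∀ {u v} → Adj G u v → Dist≤2 H u v
  Adj⇒Dist≤2 {u} {v} uv with maxClique-⊇ (u ∷ˡ v ∷ˡ []ˡ) ((const uv ∷ []) ∷ [] ∷ [])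
  ... | Q , Q-max , u∈Q ∷ v∈Q ∷ [] = by (inVF? u) (inVF? v)
    where
    by : Dec (InVF G u) → Dec (InVF G v) → Dist≤2 H u v
    by (no u∉F) _         = outsideVF-Dist≤2 u∉F Q-max u∈Q v∈Q (Adj⇒≢ uv)
    by (yes _)   (no v∉F) = Dist≤2-sym (outsideVF-Dist≤2 v∉F Q-max v∈Q u∈Q (≢-sym (Adj⇒≢ uv)))
    by (yes u∈F) (yes v∈F) = inVF-Dist≤2 Q-max u∈Q v∈Q u∈F v∈F (Adj⇒≢ uv)

  isSquare : IsSquareOf G H
  isSquare u v = mk⇔ Adj⇒Dist≤2 Dist≤2⇒Adj

  Edge-inVF⇒Forced : ∀ {u v} → InVF G u → InVF G v → Edge u v → Forced G u v
  Edge-inVF⇒Forced _ _ (inj₁ uv) = uv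
  Edge-inVF⇒Forced u∈F _ (inj₂ (inj₁ (u∉F , _))) = contradiction u∈F u∉F
  Edge-inVF⇒Forced _ v∈F (inj₂ (inj₂ (v∉F , _))) = contradiction v∈F v∉F

  outsideVF-~-unique : ∀ {x y} → ¬ InVF G x → Edge x y → y ≡ parent x
  outsideVF-~-unique x∉F (inj₁ xy) = contradiction (Forced⇒InVFˡ xy) x∉F
  outsideVF-~-unique x∉F (inj₂ (inj₁ (_ , y≡p))) = y≡p
  outsideVF-~-unique x∉F (inj₂ (inj₂ (y∉F , x≡p))) = contradiction (subst (InVF G) (sym x≡p) (parent-InVF y∉F)) x∉F

  -- A cycle inside V_F is a cycle of F; a vertex outside V_F has degree one in H, so lies on no cycle.
  H-girth : GirthAtLeast7 (Adj H)
  H-girth m 2≤m cy with all? (λ i → inVF? (Cycle.vert cy i))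
  ... | yes allInVF =
    proj₂ condV m 2≤m (Cycle-mapOn (InVF G) (λ u∈F v∈F uv → Edge-inVF⇒Forced u∈F v∈F (~⇒Edge uv)) cy allInVF)
  ... | no notAll with any? (λ i → ¬? (inVF? (Cycle.vert cy i)))
  ...   | no none = contradiction (λ i → decidable-stable (inVF? _) (λ ∉F → none (i , ∉F))) notAll
  ...   | yes (k , k∉F) with Cycle-twoNeighbours (~-sym) m 2≤m cy k
  ...     | i , j , i≢j , ki , kj =
    contradiction (Cycle.inj cy (trans (outsideVF-~-unique k∉F (~⇒Edge ki)) (sym (outsideVF-~-unique k∉F (~⇒Edge kj))))) i≢j

theorem2p4 : ∀ {n : ℕ} (G : SimpleGraph n) → Connected G → ¬ Complete G →
    (∃[ H ] (IsSquareOf G H × GirthAtLeast7 (Adj H)))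
      ⇔ (CondI G × CondII G × CondIII G × CondIV G × CondV G)
theorem2p4 G connected incomplete = mk⇔ necessary sufficient
  where
  necessary : ∃[ H ] (IsSquareOf G H × GirthAtLeast7 (Adj H)) → CondI G × CondII G × CondIII G × CondIV G × CondV G
  necessary (H , square , girth) = condI , condII , condIII , condIV , condV
    where open SquareOfHighGirth G H connected incomplete square girth
  sufficient : CondI G × CondII G × CondIII G × CondIV G × CondV G → ∃[ H ] (IsSquareOf G H × GirthAtLeast7 (Adj H))
  sufficient (i , ii , iii , iv , v) = H , isSquare , H-girth
    where open SquareRoot G i ii iii iv v
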